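{- Let $n\ge 3m$, $|\Omega|=n$, $x\in\binom{\Omega}{m}$, and let $\mathcal{T}=\mathcal{T}(x)$ be the Terwilliger algebra of $J(n,m,m+1)$ with respect to $x$. For $0\le i,j\le 2m+1$ let $\mathcal{T}_{i,j}=\{M_{i,j}: M\in\mathcal{T}\}$, where $M_{i,j}$ is the submatrix of $M$ with rows indexed by $\Gamma_i(x)$ and columns indexed by $\Gamma_j(x)$. Then for every $i\ge 0$, every $j$ with $2i+2\le j\le 2m+1$ and every $s$ with $0\le s\le i+1$, $$C^{m-\lfloor j/2\rfloor}_{m-i-1,\,m-\lfloor j/2\rfloor}(m)\otimes C^s_{i+1,\,\lceil j/2\rceil}(n-m)\in\mathcal{T}_{2i+2,j}.$$
   Context: $J(n,m,m+1)$ is the bipartite graph with vertex set $X=\binom{\Omega}{m}\cup\binom{\Omega}{m+1}$ ($\binom{S}{k}$ = set of $k$-subsets of $S$), $y\in\binom{\Omega}{m}$ adjacent to $z\in\binom{\Omega}{m+1}$ iff $y\subseteq z$; $A$ is its adjacency matrix. $\Gamma_k(x)$ is the set of vertices at distance $k$ from $x$; for $n\ge 2m+1$ the maximal distance from $x$ is $2m+1$, and $\Gamma_{2i}(x)=\{y\in\binom{\Omega}{m}:|x\cap y|=m-i\}$, $\Gamma_{2i+1}(x)=\{z\in\binom{\Omega}{m+1}:|x\cap z|=m-i\}$. $E^*_k$ is the diagonal $0/1$ matrix with $(y,y)$-entry $1$ iff $y\in\Gamma_k(x)$. The Terwilliger algebra $\mathcal{T}(x)$ is the subalgebra of $\mathrm{Mat}_X(\mathbb{C})$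 generated by $A,E^*_0,\dots,E^*_{2m+1}$. A vertex $y\in\Gamma_k(x)$ is identified with $(y\cap x,y\setminus x)\in\binom{x}{m-\lfloor k/2\rfloor}\times\binom{\Omega\setminus x}{\lceil k/2\rceil}$, and $P\otimes Q$ is the Kronecker product with $(P\otimes Q)_{(\alpha,\beta),(\alpha',\beta')}=P_{\alpha\alpha'}Q_{\beta\beta'}$. For a set $V$ of size $v$, $C^l_{i,j}(v)$ is the matrix with rows indexed by $\binom{V}{i}$, columns by $\binom{V}{j}$ and $(y,z)$-entry $\binom{|y\cap z|}{l}$; here $V=x$ ($v=m$) in the first factor and $V=\Omega\setminus x$ ($v=n-m$) in the second. -}

module Defs where

open import Data.Bool using (Bool; true; false; _∧_; _∨_; if_then_else_)
open import Data.Nat as ℕ using (ℕ; zero; suc; _≡ᵇ_; _/_; _%_)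
open import Data.Nat.Combinatorics using (_C_)
open import Data.Fin.Subset using (Subset; inside; outside; ∣_∣; _∩_; _─_)
open import Data.Fin.Subset.Properties using (_⊆?_)
open import Data.Vec using (_∷_; [])
open import Data.List using (List; []; _∷_; map; _++_; filterᵇ; foldr)
open import Data.Integer using (+_)
open import Data.Rational as ℚ using (ℚ; 0ℚ; 1ℚ)
open import Relation.Nullary.Decidable using (⌊_⌋)

-- Ω = Fin n ; subsets of Ω are Subset n.

allSubsets : (n : ℕ) → List (Subset n)
allSubsets zero = [] ∷ []
allSubsets (suc n) =
  map (outside ∷_) (allSubsets n) ++ map (inside ∷_) (allSubsets n)

inX : (n m : ℕ) → Subset n → Bool
inX n m y = (∣ y ∣ ≡ᵇ m) ∨ (∣ y ∣ ≡ᵇ suc m)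

vertices : (n m : ℕ) → List (Subset n)
vertices n m = filterᵇ (inX n m) (allSubsets n)

-- matrices indexed by X (entries at non-vertices are irrelevant)
Mat : ℕ → Set
Mat n = Subset n → Subset n → ℚ

boolℚ : Bool → ℚ
boolℚ b = if b then 1ℚ else 0ℚ

ℕtoℚ : ℕ → ℚ
ℕtoℚ k = (+ k) ℚ./ 1

adjJ : (n m : ℕ) → Mat n
adjJ n m y z = boolℚ
  ( ((∣ y ∣ ≡ᵇ m) ∧ (∣ z ∣ ≡ᵇ suc m) ∧ ⌊ y ⊆? z ⌋)
  ∨ ((∣ z ∣ ≡ᵇ m) ∧ (∣ y ∣ ≡ᵇ suc m) ∧ ⌊ z ⊆? y ⌋))

-- y ∈ Γ_k(x):  k = 2i  : |y| = m   and |x ∩ y| = m - i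
--              k = 2i+1: |y| = m+1 and |x ∩ y| = m - i
inΓ : (n m : ℕ) (x : Subset n) (k : ℕ) → Subset n → Bool
inΓ n m x k y =
  (if k % 2 ≡ᵇ 0 then ∣ y ∣ ≡ᵇ m else ∣ y ∣ ≡ᵇ suc m)
  ∧ (∣ x ∩ y ∣ ℕ.+ k / 2 ≡ᵇ m)

Estar : (n m : ℕ) (x : Subset n) (k : ℕ) → Mat n
Estar n m x k y z = boolℚ (inΓ n m x k y ∧ inΓ n m x k z ∧ ⌊ y ⊆? z ⌋ ∧ ⌊ z ⊆? y ⌋)

_⊕_ : ∀ {n} → Mat n → Mat n → Mat n
(M ⊕ N) y z = M y z ℚ.+ N y z

_·_ : ∀ {n} → ℚ → Mat n → Mat n
(c · M) y z = c ℚ.* M y z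

matMul : (n m : ℕ) → Mat n → Mat n → Mat n
matMul n m M N y z = foldr (λ w acc → M y w ℚ.* N w z ℚ.+ acc) 0ℚ (vertices n m)

data InT (n m : ℕ) (x : Subset n) : Mat n → Set where
  genA  : InT n m x (adjJ n m)
  genE  : (k : ℕ) → k ℕ.≤ 2 ℕ.* m ℕ.+ 1 → InT n m x (Estar n m x k)
  add   : ∀ {M N} → InT n m x M → InT n m x N → InT n m x (M ⊕ N)
  scale : ∀ {M} (c : ℚ) → InT n m x M → InT n m x (c · M)
  mul   : ∀ {M N} → InT n m x M → InT n m x N → InT n m x (matMul n m M N)

-- Entry ((y∩x, y∖x),(z∩x, z∖x)) of  C^l_{a,b}(m) ⊗ C^s_{c,d}(n-m):
-- binom(|(y∩x)∩(z∩x)|, l) * binom(|(y∖x)∩(z∖x)|, s)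
kronC : (n : ℕ) (x : Subset n) (l s : ℕ) → Mat n
kronC n x l s y z =
  ℕtoℚ ((∣ (y ∩ x) ∩ (z ∩ x) ∣ C l) ℕ.* (∣ (y ─ x) ∩ (z ─ x) ∣ C s))

InTblock : (n m : ℕ) (x : Subset n) (i j : ℕ) (P : Mat n) → Set
InTblock n m x i j P = Σ' where
  open import Data.Product using (Σ; _×_)
  open import Relation.Binary.PropositionalEquality using (_≡_)
  Σ' = Σ (Mat n) λ M → InT n m x M ×
         (∀ y z → inΓ n m x i y ≡ true → inΓ n m x j z ≡ true → M y z ≡ P y z)

-- Put u = i + 1.  Multiplying a matrix on the right by E*_j A moves its (2u, j)-block to the
-- (2u, j ± 1)-block, and the new (y, z)-entry is a sum over the neighbours w of z.  Adding or
-- removing one point of z changes |(y ∩ x) ∩ (z ∩ x)| or |(y ∖ x) ∩ (z ∖ x)| by at most one, so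
-- counting the neighbours and applying the absorption and Pascal identities turns C^l ⊗ C^s into a
-- positive integer multiple of the next Kronecker product.  The diagonal block of E*_{2u} is
-- C^{m-u} ⊗ C^u; going out to Γ_{2u+1} and back, and subtracting a multiple of the matrix we
-- started from, lowers s by one.  Then the alternating steps walk j from 2u up to 2m + 1.

module Submission where

open import Defs
open import Data.Bool using (Bool; true; false; _∧_; _∨_; not; if_then_else_; T)
open import Data.Bool.Properties using (∧-zeroʳ; ∧-identityʳ; ∨-identityʳ; ∧-comm; ∧-idem; ∧-assoc)
open import Data.Nat as ℕ
  using (ℕ; zero; suc; _+_; _*_; _∸_; _≤_; _<_; _≡ᵇ_; _/_; _%_; z≤n; s≤s)
open import Data.Nat.Properties as ℕP using ()
open import Data.Nat.Combinatorics using (_C_; nCn≡1; nC1≡n; k>n⇒nCk≡0; nCk+nC[k+1]≡[n+1]C[k+1])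
open import Data.Nat.Tactic.RingSolver using (solve-∀)
open import Data.Nat.DivMod using ([m+kn]%n≡m%n; +-distrib-/-∣ʳ; m*n/n≡m; m≡m%n+[m/n]*n; m%n<n; /-monoˡ-≤)
open import Data.Nat.Divisibility using (divides)
open import Algebra.Properties.CommutativeSemigroup ℕP.+-commutativeSemigroup
  using () renaming (x∙yz≈y∙xz to x+[y+z]≡y+[x+z])
open import Algebra.Properties.CommutativeSemigroup ℕP.*-commutativeSemigroup
  using () renaming (x∙yz≈y∙xz to x*[y*z]≡y*[x*z])
import Data.Integer as ℤ
open import Data.Integer using (1ℤ)
import Data.Integer.Properties as ℤP
open import Data.Rational as ℚ using (ℚ; mkℚ; 0ℚ; 1ℚ)
import Data.Rational.Properties as ℚP
open import Data.Rational.Solver using (module +-*-Solver)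
import Data.Rational.Unnormalised as ℚᵘ
import Data.Rational.Unnormalised.Properties as ℚᵘP
import Data.Nat.Coprimality as Coprime
open import Data.List using (List; []; _∷_; _++_; map; filterᵇ; foldr)
open import Data.Fin using (Fin; zero; suc)
open import Data.Vec using (_∷_; []; lookup; _[_]≔_)
import Data.Vec.Properties as VecP
open import Data.Fin.Subset using (Subset; inside; outside; ∣_∣; _∩_; _─_; ∁; ⊤)
open import Data.Fin.Subset.Properties
  using (_⊆?_; p⊆q⇒∣p∣≤∣q∣; ∣p∩q∣≤∣p∣; ∩-assoc; ∩-comm; ∩-idem; ∩-identityʳ; ∣∁p∣≡n∸∣p∣)
open import Relation.Nullary.Decidable using (⌊_⌋; does; yes; no; isYes≗does; dec-true; dec-false)
open import Relation.Binary.PropositionalEquality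
open import Data.Product using (Σ; _×_; _,_; proj₁; proj₂)
open import Data.Sum using (_⊎_; inj₁; inj₂)

⟦_⟧ : Bool → ℕ
⟦ true ⟧ = 1
⟦ false ⟧ = 0

-- `does (a ℕ.≟ b)` reduces to `a ≡ᵇ b`, so the generic facts about `does` apply.
≡ᵇ-true : ∀ {a b} → a ≡ b → (a ≡ᵇ b) ≡ true
≡ᵇ-true {a} {b} = dec-true (a ℕ.≟ b)

≡ᵇ-false : ∀ {a b} → a ≢ b → (a ≡ᵇ b) ≡ false
≡ᵇ-false {a} {b} = dec-false (a ℕ.≟ b)

≡ᵇ-sound : ∀ {a b} → (a ≡ᵇ b) ≡ true → a ≡ b
≡ᵇ-sound {a} {b} eq = ℕP.≡ᵇ⇒≡ a b (subst T (sym eq) _)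

≡ᵇ-comm : ∀ a b → (a ≡ᵇ b) ≡ (b ≡ᵇ a)
≡ᵇ-comm zero    zero    = refl
≡ᵇ-comm zero    (suc b) = refl
≡ᵇ-comm (suc a) zero    = refl
≡ᵇ-comm (suc a) (suc b) = ≡ᵇ-comm a b

∧-true-left : ∀ {a b} → a ∧ b ≡ true → a ≡ true
∧-true-left {true} _ = refl

∧-true-right : ∀ {a b} → a ∧ b ≡ true → b ≡ true
∧-true-right {true} eq = eq

[⟦b⟧+2g]%2≡⟦b⟧ : ∀ b g → (⟦ b ⟧ + 2 * g) % 2 ≡ ⟦ b ⟧
[⟦b⟧+2g]%2≡⟦b⟧ b g = begin
  (⟦ b ⟧ + 2 * g) % 2  ≡⟨ cong (λ k → (⟦ b ⟧ + k) % 2) (ℕP.*-comm 2 g) ⟩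
  (⟦ b ⟧ + g * 2) % 2  ≡⟨ [m+kn]%n≡m%n ⟦ b ⟧ g 2 ⟩
  ⟦ b ⟧ % 2            ≡⟨ ⟦b⟧%2≡⟦b⟧ b ⟩
  ⟦ b ⟧                ∎
  where
  open ≡-Reasoning
  ⟦b⟧%2≡⟦b⟧ : ∀ b → ⟦ b ⟧ % 2 ≡ ⟦ b ⟧
  ⟦b⟧%2≡⟦b⟧ true  = refl
  ⟦b⟧%2≡⟦b⟧ false = refl

[⟦b⟧+2g]/2≡g : ∀ b g → (⟦ b ⟧ + 2 * g) / 2 ≡ g
[⟦b⟧+2g]/2≡g b g = begin
  (⟦ b ⟧ + 2 * g) / 2      ≡⟨ cong (λ k → (⟦ b ⟧ + k) / 2) (ℕP.*-comm 2 g) ⟩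
  (⟦ b ⟧ + g * 2) / 2      ≡⟨ +-distrib-/-∣ʳ ⟦ b ⟧ (divides g refl) ⟩
  ⟦ b ⟧ / 2 + g * 2 / 2    ≡⟨ cong₂ _+_ (⟦b⟧/2≡0 b) (m*n/n≡m g 2) ⟩
  g                        ∎
  where
  open ≡-Reasoning
  ⟦b⟧/2≡0 : ∀ b → ⟦ b ⟧ / 2 ≡ 0
  ⟦b⟧/2≡0 true  = refl
  ⟦b⟧/2≡0 false = refl

j≡⟦b⟧+2[j/2] : ∀ j → Σ Bool λ b → j ≡ ⟦ b ⟧ + 2 * (j / 2)
j≡⟦b⟧+2[j/2] j = proj₁ j%2≡⟦b⟧ , trans (m≡m%n+[m/n]*n j 2) (cong₂ _+_ (proj₂ j%2≡⟦b⟧) (ℕP.*-comm (j / 2) 2))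
  where
  bit : ∀ r → r < 2 → Σ Bool λ b → r ≡ ⟦ b ⟧
  bit 0             _                 = false , refl
  bit 1             _                 = true , refl
  bit (suc (suc _)) (s≤s (s≤s ()))
  j%2≡⟦b⟧ = bit (j % 2) (m%n<n j 2)

2g≤2m+1 : ∀ {g m} → g ≤ m → 2 * g ≤ 2 * m + 1
2g≤2m+1 g≤m = ℕP.m≤n⇒m≤n+o 1 (ℕP.*-monoʳ-≤ 2 g≤m)

3m≤n⇒m≤n∸m∸u : ∀ {m n u} → 3 * m ≤ n → u ≤ m → m ≤ n ∸ m ∸ u
3m≤n⇒m≤n∸m∸u {m} {n} {u} 3m≤n u≤m = ℕP.m+n≤o⇒m≤o∸n m (ℕP.m+n≤o⇒m≤o∸n (m + u) (begin
  m + u + m  ≤⟨ ℕP.+-monoˡ-≤ m (ℕP.+-monoʳ-≤ m u≤m) ⟩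
  m + m + m  ≡⟨ m+m+m≡3m m ⟩
  3 * m      ≤⟨ 3m≤n ⟩
  n          ∎))
  where
  open ℕP.≤-Reasoning
  m+m+m≡3m : ∀ m → m + m + m ≡ 3 * m
  m+m+m≡3m = solve-∀

1+2g≤2m+1 : ∀ {g m} → g ≤ m → suc (2 * g) ≤ 2 * m + 1
1+2g≤2m+1 {g} {m} g≤m = subst (suc (2 * g) ≤_) (ℕP.+-comm 1 (2 * m)) (s≤s (ℕP.*-monoʳ-≤ 2 g≤m))

-- Binomial coefficients

[1+k]*[1+n]C[1+k]≡[1+n]*nCk : ∀ n k → suc k * (suc n C suc k) ≡ suc n * (n C k)
[1+k]*[1+n]C[1+k]≡[1+n]*nCk n       zero    = trans (ℕP.+-identityʳ _) (trans (nC1≡n (suc n)) (sym (ℕP.*-identityʳ (suc n))))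
[1+k]*[1+n]C[1+k]≡[1+n]*nCk zero    (suc k) = begin
  suc (suc k) * (1 C suc (suc k))  ≡⟨ cong (suc (suc k) *_) (k>n⇒nCk≡0 (s≤s (s≤s (z≤n {k})))) ⟩
  suc (suc k) * 0                  ≡⟨ ℕP.*-zeroʳ (suc (suc k)) ⟩
  0                                ≡⟨ cong (1 *_) (k>n⇒nCk≡0 (s≤s (z≤n {k}))) ⟨
  1 * (0 C suc k)                  ∎
  where open ≡-Reasoning
[1+k]*[1+n]C[1+k]≡[1+n]*nCk (suc n) (suc k) = begin
  suc (suc k) * (suc (suc n) C suc (suc k))
    ≡⟨ cong (suc (suc k) *_) (nCk+nC[k+1]≡[n+1]C[k+1] (suc n) (suc k)) ⟨
  suc (suc k) * (suc n C suc k + suc n C suc (suc k))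
    ≡⟨ regroup (suc n C suc k) (suc n C suc (suc k)) k ⟩
  suc n C suc k + (suc k * (suc n C suc k) + suc (suc k) * (suc n C suc (suc k)))
    ≡⟨ cong₂ (λ a b → suc n C suc k + (a + b)) ([1+k]*[1+n]C[1+k]≡[1+n]*nCk n k) ([1+k]*[1+n]C[1+k]≡[1+n]*nCk n (suc k)) ⟩
  suc n C suc k + (suc n * (n C k) + suc n * (n C suc k))
    ≡⟨ cong ((suc n C suc k) +_) (ℕP.*-distribˡ-+ (suc n) (n C k) (n C suc k)) ⟨
  suc n C suc k + suc n * (n C k + n C suc k)
    ≡⟨ cong (λ c → suc n C suc k + suc n * c) (nCk+nC[k+1]≡[n+1]C[k+1] n k) ⟩
  suc (suc n) * (suc n C suc k) ∎
  where
  open ≡-Reasoning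
  regroup : ∀ a b k → suc (suc k) * (a + b) ≡ a + (suc k * a + suc (suc k) * b)
  regroup = solve-∀

[n∸k]*nCk≡[1+k]*nC[1+k] : ∀ n k → (n ∸ k) * (n C k) ≡ suc k * (n C suc k)
[n∸k]*nCk≡[1+k]*nC[1+k] n k with ℕP.≤-<-connex k n
... | inj₁ k≤n = ℕP.+-cancelʳ-≡ (suc k * (n C k)) _ _ (begin
  (n ∸ k) * (n C k) + suc k * (n C k)       ≡⟨ ℕP.*-distribʳ-+ (n C k) (n ∸ k) (suc k) ⟨
  (n ∸ k + suc k) * (n C k)                 ≡⟨ cong (_* (n C k)) (trans (ℕP.+-suc (n ∸ k) k) (cong suc (ℕP.m∸n+n≡m k≤n))) ⟩
  suc n * (n C k)                           ≡⟨ [1+k]*[1+n]C[1+k]≡[1+n]*nCk n k ⟨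
  suc k * (suc n C suc k)                   ≡⟨ cong (suc k *_) (nCk+nC[k+1]≡[n+1]C[k+1] n k) ⟨
  suc k * (n C k + n C suc k)               ≡⟨ ℕP.*-distribˡ-+ (suc k) (n C k) (n C suc k) ⟩
  suc k * (n C k) + suc k * (n C suc k)     ≡⟨ ℕP.+-comm (suc k * (n C k)) _ ⟩
  suc k * (n C suc k) + suc k * (n C k)     ∎)
  where open ≡-Reasoning
... | inj₂ n<k = begin
  (n ∸ k) * (n C k)        ≡⟨ cong ((n ∸ k) *_) (k>n⇒nCk≡0 n<k) ⟩
  (n ∸ k) * 0              ≡⟨ ℕP.*-zeroʳ (n ∸ k) ⟩
  0                        ≡⟨ ℕP.*-zeroʳ (suc k) ⟨
  suc k * 0                ≡⟨ cong (suc k *_) (k>n⇒nCk≡0 (ℕP.m<n⇒m<1+n n<k)) ⟨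
  suc k * (n C suc k)      ∎
  where open ≡-Reasoning

n*[n∸1]Ck≡[n∸k]*nCk : ∀ n k → n * ((n ∸ 1) C k) ≡ (n ∸ k) * (n C k)
n*[n∸1]Ck≡[n∸k]*nCk zero    k = cong (_* (0 C k)) (sym (ℕP.0∸n≡0 k))
n*[n∸1]Ck≡[n∸k]*nCk (suc n) k =
  trans (sym ([1+k]*[1+n]C[1+k]≡[1+n]*nCk n k)) (sym ([n∸k]*nCk≡[1+k]*nC[1+k] (suc n) k))

[a+[n∸k]]*nCk≡[a+n∸k]*nCk : ∀ a n k → (a + (n ∸ k)) * (n C k) ≡ (a + n ∸ k) * (n C k)
[a+[n∸k]]*nCk≡[a+n∸k]*nCk a n k with ℕP.≤-<-connex k n
... | inj₁ k≤n = cong (_* (n C k)) (sym (ℕP.+-∸-assoc a k≤n))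
... | inj₂ n<k = begin
  (a + (n ∸ k)) * (n C k)  ≡⟨ cong ((a + (n ∸ k)) *_) (k>n⇒nCk≡0 n<k) ⟩
  (a + (n ∸ k)) * 0        ≡⟨ ℕP.*-zeroʳ (a + (n ∸ k)) ⟩
  0                        ≡⟨ ℕP.*-zeroʳ (a + n ∸ k) ⟨
  (a + n ∸ k) * 0          ≡⟨ cong ((a + n ∸ k) *_) (k>n⇒nCk≡0 n<k) ⟨
  (a + n ∸ k) * (n C k)    ∎
  where open ≡-Reasoning

n*[n∸1]Ck+q*nCk≡[q+n∸k]*nCk : ∀ n q k → n * ((n ∸ 1) C k) + q * (n C k) ≡ (q + n ∸ k) * (n C k)
n*[n∸1]Ck+q*nCk≡[q+n∸k]*nCk n q k = begin
  n * ((n ∸ 1) C k) + q * (n C k)   ≡⟨ cong (_+ q * (n C k)) (n*[n∸1]Ck≡[n∸k]*nCk n k) ⟩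
  (n ∸ k) * (n C k) + q * (n C k)   ≡⟨ ℕP.*-distribʳ-+ (n C k) (n ∸ k) q ⟨
  ((n ∸ k) + q) * (n C k)           ≡⟨ cong (_* (n C k)) (ℕP.+-comm (n ∸ k) q) ⟩
  (q + (n ∸ k)) * (n C k)           ≡⟨ [a+[n∸k]]*nCk≡[a+n∸k]*nCk q n k ⟩
  (q + n ∸ k) * (n C k)             ∎
  where open ≡-Reasoning

c*[1+t]C[1+a]+d*tC[1+a]≡k*tCa : ∀ {c d t a k} → t ≤ a → c + t ≡ k + a →
  c * (suc t C suc a) + d * (t C suc a) ≡ k * (t C a)
c*[1+t]C[1+a]+d*tC[1+a]≡k*tCa {c} {d} {t} {a} {k} t≤a c+t≡k+a with ℕP.m≤n⇒m<n∨m≡n t≤a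
... | inj₂ refl = begin
  c * (suc t C suc t) + d * (t C suc t)  ≡⟨ cong₂ (λ p q → c * p + d * q) (nCn≡1 (suc t)) (k>n⇒nCk≡0 (ℕP.n<1+n t)) ⟩
  c * 1 + d * 0                          ≡⟨ cong₂ _+_ (cong (_* 1) (ℕP.+-cancelʳ-≡ t c k c+t≡k+a)) (ℕP.*-zeroʳ d) ⟩
  k * 1 + 0                              ≡⟨ trans (ℕP.+-identityʳ (k * 1)) (cong (k *_) (sym (nCn≡1 t))) ⟩
  k * (t C t)                            ∎
  where open ≡-Reasoning
... | inj₁ t<a = begin
  c * (suc t C suc a) + d * (t C suc a)  ≡⟨ cong₂ (λ p q → c * p + d * q) (k>n⇒nCk≡0 (s≤s t<a)) (k>n⇒nCk≡0 (ℕP.m<n⇒m<1+n t<a)) ⟩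
  c * 0 + d * 0                          ≡⟨ cong₂ _+_ (ℕP.*-zeroʳ c) (ℕP.*-zeroʳ d) ⟩
  0                                      ≡⟨ trans (cong (k *_) (k>n⇒nCk≡0 t<a)) (ℕP.*-zeroʳ k) ⟨
  k * (t C a)                            ∎
  where open ≡-Reasoning

c*[1+r]C[1+s]+d*rC[1+s]≡[c+d∸1+s]*rC[1+s]+[c+r∸s]*rCs : ∀ c d r s → suc s ≤ c + d →
  c * (suc r C suc s) + d * (r C suc s) ≡ (c + d ∸ suc s) * (r C suc s) + (c + r ∸ s) * (r C s)
c*[1+r]C[1+s]+d*rC[1+s]≡[c+d∸1+s]*rC[1+s]+[c+r∸s]*rCs c d r s 1+s≤c+d = begin
  c * (suc r C suc s) + d * B                    ≡⟨ cong (λ p → c * p + d * B) (nCk+nC[k+1]≡[n+1]C[k+1] r s) ⟨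
  c * (A + B) + d * B                            ≡⟨ regroup c d A B ⟩
  c * A + (c + d) * B                            ≡⟨ cong (λ p → c * A + p * B) (ℕP.m∸n+n≡m 1+s≤c+d) ⟨
  c * A + (K + suc s) * B                        ≡⟨ regroup′ c K (suc s) A B ⟩
  K * B + (c * A + suc s * B)                    ≡⟨ cong (λ p → K * B + (c * A + p)) ([n∸k]*nCk≡[1+k]*nC[1+k] r s) ⟨
  K * B + (c * A + (r ∸ s) * A)                  ≡⟨ cong (K * B +_) (ℕP.*-distribʳ-+ A c (r ∸ s)) ⟨
  K * B + (c + (r ∸ s)) * A                      ≡⟨ cong (K * B +_) ([a+[n∸k]]*nCk≡[a+n∸k]*nCk c r s) ⟩
  K * B + (c + r ∸ s) * A                        ∎
  where
  open ≡-Reasoning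
  A = r C s
  B = r C suc s
  K = c + d ∸ suc s
  regroup : ∀ c d a b → c * (a + b) + d * b ≡ c * a + (c + d) * b
  regroup = solve-∀
  regroup′ : ∀ c k t a b → c * a + (k + t) * b ≡ k * b + (c * a + t * b)
  regroup′ = solve-∀

tCa*uCb≡⟦t+u≡ᵇa+b⟧ : ∀ {t u a b} → t ≤ a → u ≤ b → (t C a) * (u C b) ≡ ⟦ t + u ≡ᵇ a + b ⟧
tCa*uCb≡⟦t+u≡ᵇa+b⟧ {t} {u} {a} {b} t≤a u≤b with ℕP.m≤n⇒m<n∨m≡n t≤a | ℕP.m≤n⇒m<n∨m≡n u≤b
... | inj₂ refl | inj₂ refl = trans (cong₂ _*_ (nCn≡1 t) (nCn≡1 u)) (cong ⟦_⟧ (sym (≡ᵇ-true {t + u} refl)))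
... | inj₁ t<a  | _         = trans (cong (_* (u C b)) (k>n⇒nCk≡0 t<a))
                                    (cong ⟦_⟧ (sym (≡ᵇ-false (ℕP.<⇒≢ (ℕP.+-mono-<-≤ t<a u≤b)))))
... | inj₂ refl | inj₁ u<b  = trans (trans (cong ((t C t) *_) (k>n⇒nCk≡0 u<b)) (ℕP.*-zeroʳ (t C t)))
                                    (cong ⟦_⟧ (sym (≡ᵇ-false (ℕP.<⇒≢ (ℕP.+-monoʳ-< t u<b)))))

ℕtoℚ≡mkℚ : ∀ k → ℕtoℚ k ≡ mkℚ (ℤ.+ k) 0 (Coprime.sym (Coprime.1-coprimeTo k))
ℕtoℚ≡mkℚ k = ℚP.normalize-coprime (Coprime.sym (Coprime.1-coprimeTo k))

ℕtoℚ-+ : ∀ a b → ℕtoℚ (a + b) ≡ ℕtoℚ a ℚ.+ ℕtoℚ b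
ℕtoℚ-+ a b = ℚP.toℚᵘ-injective (begin
  ℚ.toℚᵘ (ℕtoℚ (a + b))                     ≈⟨ ℚP.toℚᵘ-cong (ℕtoℚ≡mkℚ (a + b)) ⟩
  ℚᵘ.mkℚᵘ (ℤ.+ (a + b)) 0                   ≈⟨ ℚᵘ.*≡* (cong (ℤ._* 1ℤ) +[a+b]≡) ⟩
  ℚᵘ.mkℚᵘ (ℤ.+ a) 0 ℚᵘ.+ ℚᵘ.mkℚᵘ (ℤ.+ b) 0  ≈⟨ ℚᵘP.+-cong (ℚP.toℚᵘ-cong (ℕtoℚ≡mkℚ a)) (ℚP.toℚᵘ-cong (ℕtoℚ≡mkℚ b)) ⟨
  ℚ.toℚᵘ (ℕtoℚ a) ℚᵘ.+ ℚ.toℚᵘ (ℕtoℚ b)      ≈⟨ ℚP.toℚᵘ-homo-+ (ℕtoℚ a) (ℕtoℚ b) ⟨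
  ℚ.toℚᵘ (ℕtoℚ a ℚ.+ ℕtoℚ b)                ∎)
  where
  open ℚᵘP.≃-Reasoning
  +[a+b]≡ : ℤ.+ (a + b) ≡ ℤ.+ a ℤ.* 1ℤ ℤ.+ ℤ.+ b ℤ.* 1ℤ
  +[a+b]≡ = trans (ℤP.pos-+ a b) (sym (cong₂ ℤ._+_ (ℤP.*-identityʳ (ℤ.+ a)) (ℤP.*-identityʳ (ℤ.+ b))))

ℕtoℚ-* : ∀ a b → ℕtoℚ (a * b) ≡ ℕtoℚ a ℚ.* ℕtoℚ b
ℕtoℚ-* a b = ℚP.toℚᵘ-injective (begin
  ℚ.toℚᵘ (ℕtoℚ (a * b))                     ≈⟨ ℚP.toℚᵘ-cong (ℕtoℚ≡mkℚ (a * b)) ⟩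
  ℚᵘ.mkℚᵘ (ℤ.+ (a * b)) 0                   ≈⟨ ℚᵘ.*≡* (cong (ℤ._* 1ℤ) (ℤP.pos-* a b)) ⟩
  ℚᵘ.mkℚᵘ (ℤ.+ a) 0 ℚᵘ.* ℚᵘ.mkℚᵘ (ℤ.+ b) 0  ≈⟨ ℚᵘP.*-cong (ℚP.toℚᵘ-cong (ℕtoℚ≡mkℚ a)) (ℚP.toℚᵘ-cong (ℕtoℚ≡mkℚ b)) ⟨
  ℚ.toℚᵘ (ℕtoℚ a) ℚᵘ.* ℚ.toℚᵘ (ℕtoℚ b)      ≈⟨ ℚP.toℚᵘ-homo-* (ℕtoℚ a) (ℕtoℚ b) ⟨
  ℚ.toℚᵘ (ℕtoℚ a ℚ.* ℕtoℚ b)                ∎)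
  where open ℚᵘP.≃-Reasoning

boolℚ≡ℕtoℚ⟦⟧ : ∀ b → boolℚ b ≡ ℕtoℚ ⟦ b ⟧
boolℚ≡ℕtoℚ⟦⟧ true = refl
boolℚ≡ℕtoℚ⟦⟧ false = refl

ℕtoℚ-suc-nonZero : ∀ k → ℚ.NonZero (ℕtoℚ (suc k))
ℕtoℚ-suc-nonZero k = subst ℚ.NonZero (sym (ℕtoℚ≡mkℚ (suc k))) _

1/suc : ℕ → ℚ
1/suc k = ℚ.1/_ (ℕtoℚ (suc k)) {{ℕtoℚ-suc-nonZero k}}

1/suc-cancel : ∀ k q → 1/suc k ℚ.* (ℕtoℚ (suc k) ℚ.* q) ≡ q
1/suc-cancel k q = begin
  1/suc k ℚ.* (ℕtoℚ (suc k) ℚ.* q)  ≡⟨ ℚP.*-assoc (1/suc k) (ℕtoℚ (suc k)) q ⟨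
  (1/suc k ℚ.* ℕtoℚ (suc k)) ℚ.* q  ≡⟨ cong (ℚ._* q) (ℚP.*-inverseˡ (ℕtoℚ (suc k)) {{ℕtoℚ-suc-nonZero k}}) ⟩
  1ℚ ℚ.* q                           ≡⟨ ℚP.*-identityˡ q ⟩
  q                                  ∎
  where open ≡-Reasoning

a*b+c+[-a]*b≡c : ∀ a b c → (a ℚ.* b ℚ.+ c) ℚ.+ (ℚ.- a) ℚ.* b ≡ c
a*b+c+[-a]*b≡c = solve 3 (λ a b c → (a :* b :+ c) :+ (:- a) :* b := c) refl
  where open +-*-Solver

if-then-*boolℚ-∧ : ∀ (p c : Bool) (q : ℚ) a →
  (if p then q ℚ.* boolℚ (a ∧ c) else 0ℚ) ≡ (if c then (if p then q ℚ.* boolℚ a else 0ℚ) else 0ℚ)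
if-then-*boolℚ-∧ true  true  q a = cong (λ b → q ℚ.* boolℚ b) (∧-identityʳ a)
if-then-*boolℚ-∧ true  false q a = trans (cong (λ b → q ℚ.* boolℚ b) (∧-zeroʳ a)) (ℚP.*-zeroʳ q)
if-then-*boolℚ-∧ false true  q a = refl
if-then-*boolℚ-∧ false false q a = refl

-- Cardinalities of subsets

∣p∩q∣+∣p∩∁q∣≡∣p∣ : ∀ {n} (p q : Subset n) → ∣ p ∩ q ∣ + ∣ p ∩ ∁ q ∣ ≡ ∣ p ∣
∣p∩q∣+∣p∩∁q∣≡∣p∣ []            []            = refl
∣p∩q∣+∣p∩∁q∣≡∣p∣ (outside ∷ p) (_ ∷ q)       = ∣p∩q∣+∣p∩∁q∣≡∣p∣ p q
∣p∩q∣+∣p∩∁q∣≡∣p∣ (inside ∷ p)  (inside ∷ q)  = cong suc (∣p∩q∣+∣p∩∁q∣≡∣p∣ p q)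
∣p∩q∣+∣p∩∁q∣≡∣p∣ (inside ∷ p)  (outside ∷ q) =
  trans (ℕP.+-suc ∣ p ∩ q ∣ _) (cong suc (∣p∩q∣+∣p∩∁q∣≡∣p∣ p q))

∣p∩∁q∣≡ : ∀ {n} (p q : Subset n) a {b c} → ∣ p ∣ ≡ a + c → ∣ p ∩ q ∣ + b ≡ c → ∣ p ∩ ∁ q ∣ ≡ a + b
∣p∩∁q∣≡ p q a {b} {c} ∣p∣≡ ∣p∩q∣+b≡ = ℕP.+-cancelˡ-≡ ∣ p ∩ q ∣ _ _ (begin
  ∣ p ∩ q ∣ + ∣ p ∩ ∁ q ∣  ≡⟨ ∣p∩q∣+∣p∩∁q∣≡∣p∣ p q ⟩
  ∣ p ∣                    ≡⟨ ∣p∣≡ ⟩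
  a + c                    ≡⟨ cong (a +_) ∣p∩q∣+b≡ ⟨
  a + (∣ p ∩ q ∣ + b)      ≡⟨ x+[y+z]≡y+[x+z] a ∣ p ∩ q ∣ b ⟩
  ∣ p ∩ q ∣ + (a + b)      ∎)
  where open ≡-Reasoning

∣p[i]≔inside∩q∣ : ∀ {n} (p q : Subset n) i →
  ∣ (p [ i ]≔ inside) ∩ q ∣ ≡ ⟦ lookup q i ⟧ + ∣ (p [ i ]≔ outside) ∩ q ∣
∣p[i]≔inside∩q∣ (_ ∷ p)       (inside ∷ q)  zero    = refl
∣p[i]≔inside∩q∣ (_ ∷ p)       (outside ∷ q) zero    = refl
∣p[i]≔inside∩q∣ (outside ∷ p) (_ ∷ q)       (suc i) = ∣p[i]≔inside∩q∣ p q i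
∣p[i]≔inside∩q∣ (inside ∷ p)  (outside ∷ q) (suc i) = ∣p[i]≔inside∩q∣ p q i
∣p[i]≔inside∩q∣ (inside ∷ p)  (inside ∷ q)  (suc i) =
  trans (cong suc (∣p[i]≔inside∩q∣ p q i)) (sym (ℕP.+-suc ⟦ lookup q i ⟧ _))

∣p∩q∣-remove : ∀ {n} (p : Subset n) i → lookup p i ≡ true → ∀ q →
  ∣ p ∩ q ∣ ≡ ⟦ lookup q i ⟧ + ∣ (p [ i ]≔ outside) ∩ q ∣
∣p∩q∣-remove p i i∈p q = begin
  ∣ p ∩ q ∣                                   ≡⟨ cong (λ v → ∣ v ∩ q ∣) p≡p[i]≔inside ⟩
  ∣ (p [ i ]≔ inside) ∩ q ∣                   ≡⟨ ∣p[i]≔inside∩q∣ p q i ⟩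
  ⟦ lookup q i ⟧ + ∣ (p [ i ]≔ outside) ∩ q ∣ ∎
  where
  open ≡-Reasoning
  p≡p[i]≔inside : p ≡ p [ i ]≔ inside
  p≡p[i]≔inside = trans (sym (VecP.[]≔-lookup p i)) (cong (p [ i ]≔_) i∈p)

∣p∩q∣-insert : ∀ {n} (p : Subset n) i → lookup p i ≡ false → ∀ q →
  ∣ (p [ i ]≔ inside) ∩ q ∣ ≡ ⟦ lookup q i ⟧ + ∣ p ∩ q ∣
∣p∩q∣-insert p i i∉p q = begin
  ∣ (p [ i ]≔ inside) ∩ q ∣                   ≡⟨ ∣p[i]≔inside∩q∣ p q i ⟩
  ⟦ lookup q i ⟧ + ∣ (p [ i ]≔ outside) ∩ q ∣ ≡⟨ cong (λ v → ⟦ lookup q i ⟧ + ∣ v ∩ q ∣) p[i]≔outside≡p ⟩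
  ⟦ lookup q i ⟧ + ∣ p ∩ q ∣                  ∎
  where
  open ≡-Reasoning
  p[i]≔outside≡p : p [ i ]≔ outside ≡ p
  p[i]≔outside≡p = trans (cong (p [ i ]≔_) (sym i∉p)) (VecP.[]≔-lookup p i)

∣p∣≡∣p∩⊤∣ : ∀ {n} (p : Subset n) → ∣ p ∣ ≡ ∣ p ∩ ⊤ ∣
∣p∣≡∣p∩⊤∣ p = cong ∣_∣ (sym (∩-identityʳ p))

∣p∣-remove : ∀ {n} (p : Subset n) i → lookup p i ≡ true → ∣ p ∣ ≡ suc ∣ p [ i ]≔ outside ∣
∣p∣-remove p i i∈p = begin
  ∣ p ∣                                          ≡⟨ ∣p∣≡∣p∩⊤∣ p ⟩
  ∣ p ∩ ⊤ ∣                                      ≡⟨ ∣p∩q∣-remove p i i∈p ⊤ ⟩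
  ⟦ lookup ⊤ i ⟧ + ∣ (p [ i ]≔ outside) ∩ ⊤ ∣
    ≡⟨ cong₂ (λ b c → ⟦ b ⟧ + c) (VecP.lookup-replicate i inside) (sym (∣p∣≡∣p∩⊤∣ (p [ i ]≔ outside))) ⟩
  suc ∣ p [ i ]≔ outside ∣                       ∎
  where open ≡-Reasoning

∣p∣-insert : ∀ {n} (p : Subset n) i → lookup p i ≡ false → ∣ p [ i ]≔ inside ∣ ≡ suc ∣ p ∣
∣p∣-insert p i i∉p = begin
  ∣ p [ i ]≔ inside ∣                 ≡⟨ ∣p∣≡∣p∩⊤∣ (p [ i ]≔ inside) ⟩
  ∣ (p [ i ]≔ inside) ∩ ⊤ ∣           ≡⟨ ∣p∩q∣-insert p i i∉p ⊤ ⟩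
  ⟦ lookup ⊤ i ⟧ + ∣ p ∩ ⊤ ∣          ≡⟨ cong₂ (λ b c → ⟦ b ⟧ + c) (VecP.lookup-replicate i inside) (sym (∣p∣≡∣p∩⊤∣ p)) ⟩
  suc ∣ p ∣                           ∎
  where open ≡-Reasoning

∈∁⇒∉ : ∀ {n} {p : Subset n} {i} → lookup (∁ p) i ≡ true → lookup p i ≡ false
∈∁⇒∉ {p = p} {i} i∈∁p = not-true (trans (sym (VecP.lookup-map i not p)) i∈∁p)
  where
  not-true : ∀ {b} → not b ≡ true → b ≡ false
  not-true {false} _ = refl

p─q≡p∩∁q : ∀ {n} (p q : Subset n) → p ─ q ≡ p ∩ ∁ q
p─q≡p∩∁q []      []            = refl
p─q≡p∩∁q (a ∷ p) (inside ∷ q)  = cong₂ _∷_ (sym (∧-zeroʳ a)) (p─q≡p∩∁q p q)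
p─q≡p∩∁q (a ∷ p) (outside ∷ q) = cong₂ _∷_ (sym (∧-identityʳ a)) (p─q≡p∩∁q p q)

[p∩r]∩[q∩r]≡q∩[r∩p] : ∀ {n} (p q r : Subset n) → (p ∩ r) ∩ (q ∩ r) ≡ q ∩ (r ∩ p)
[p∩r]∩[q∩r]≡q∩[r∩p] p q r = begin
  (p ∩ r) ∩ (q ∩ r)   ≡⟨ ∩-comm (p ∩ r) (q ∩ r) ⟩
  (q ∩ r) ∩ (p ∩ r)   ≡⟨ ∩-assoc q r (p ∩ r) ⟩
  q ∩ (r ∩ (p ∩ r))   ≡⟨ cong (λ s → q ∩ (r ∩ s)) (∩-comm p r) ⟩
  q ∩ (r ∩ (r ∩ p))   ≡⟨ cong (q ∩_) (∩-assoc r r p) ⟨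
  q ∩ ((r ∩ r) ∩ p)   ≡⟨ cong (λ s → q ∩ (s ∩ p)) (∩-idem r) ⟩
  q ∩ (r ∩ p)         ∎
  where open ≡-Reasoning

⊆∧≡ᵇsuc≡false : ∀ {n} (v w : Subset n) → does (v ⊆? w) ∧ (∣ v ∣ ≡ᵇ suc ∣ w ∣) ≡ false
⊆∧≡ᵇsuc≡false v w with v ⊆? w
... | yes v⊆w = ≡ᵇ-false (λ eq → ℕP.≤⇒≯ (p⊆q⇒∣p∣≤∣q∣ v⊆w) (ℕP.≤-reflexive (sym eq)))
... | no _    = refl

does-⊆?≡∣p∩q∣≡ᵇ∣p∣ : ∀ {n} (p q : Subset n) → does (p ⊆? q) ≡ (∣ p ∩ q ∣ ≡ᵇ ∣ p ∣)
does-⊆?≡∣p∩q∣≡ᵇ∣p∣ []            []            = refl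
does-⊆?≡∣p∩q∣≡ᵇ∣p∣ (outside ∷ p) (_ ∷ q)       = does-⊆?≡∣p∩q∣≡ᵇ∣p∣ p q
does-⊆?≡∣p∩q∣≡ᵇ∣p∣ (inside ∷ p)  (inside ∷ q)  = does-⊆?≡∣p∩q∣≡ᵇ∣p∣ p q
does-⊆?≡∣p∩q∣≡ᵇ∣p∣ (inside ∷ p)  (outside ∷ q) =
  sym (≡ᵇ-false (λ eq → ℕP.≤⇒≯ (∣p∩q∣≤∣p∣ p q) (ℕP.≤-reflexive (sym eq))))

_⊆[_]_ : ∀ {n} → Subset n → ℕ → Subset n → Bool
w ⊆[ d ] z = does (w ⊆? z) ∧ (d + ∣ w ∣ ≡ᵇ ∣ z ∣)

⊆∧⊇≡⊆[0] : ∀ {n} (v w : Subset n) → does (v ⊆? w) ∧ does (w ⊆? v) ≡ w ⊆[ 0 ] v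
⊆∧⊇≡⊆[0] []            []            = refl
⊆∧⊇≡⊆[0] (outside ∷ v) (outside ∷ w) = ⊆∧⊇≡⊆[0] v w
⊆∧⊇≡⊆[0] (outside ∷ v) (inside ∷ w)  = ∧-zeroʳ (does (v ⊆? w))
⊆∧⊇≡⊆[0] (inside ∷ v)  (outside ∷ w) = sym (⊆∧≡ᵇsuc≡false w v)
⊆∧⊇≡⊆[0] (inside ∷ v)  (inside ∷ w)  = ⊆∧⊇≡⊆[0] v w

-- Sums over subsets and over elements

sumL : ∀ {A : Set} → List A → (A → ℚ) → ℚ
sumL l f = foldr (λ a acc → f a ℚ.+ acc) 0ℚ l

sumL-++ : ∀ {A : Set} (l₁ l₂ : List A) f → sumL (l₁ ++ l₂) f ≡ sumL l₁ f ℚ.+ sumL l₂ f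
sumL-++ []       l₂ f = sym (ℚP.+-identityˡ _)
sumL-++ (a ∷ l₁) l₂ f = trans (cong (f a ℚ.+_) (sumL-++ l₁ l₂ f)) (sym (ℚP.+-assoc (f a) _ _))

sumL-map : ∀ {A B : Set} (h : A → B) (l : List A) f → sumL (map h l) f ≡ sumL l (λ a → f (h a))
sumL-map h []      f = refl
sumL-map h (a ∷ l) f = cong (f (h a) ℚ.+_) (sumL-map h l f)

sumL-cong : ∀ {A : Set} (l : List A) {f g : A → ℚ} → (∀ a → f a ≡ g a) → sumL l f ≡ sumL l g
sumL-cong []      f≗g = refl
sumL-cong (a ∷ l) f≗g = cong₂ ℚ._+_ (f≗g a) (sumL-cong l f≗g)

sumL-zero : ∀ {A : Set} (l : List A) → sumL l (λ _ → 0ℚ) ≡ 0ℚ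
sumL-zero []      = refl
sumL-zero (a ∷ l) = trans (ℚP.+-identityˡ _) (sumL-zero l)

sumL-filterᵇ : ∀ {A : Set} (p : A → Bool) (l : List A) f →
  sumL (filterᵇ p l) f ≡ sumL l (λ a → if p a then f a else 0ℚ)
sumL-filterᵇ p []      f = refl
sumL-filterᵇ p (a ∷ l) f with p a
... | true  = cong (f a ℚ.+_) (sumL-filterᵇ p l f)
... | false = trans (sumL-filterᵇ p l f) (sym (ℚP.+-identityˡ _))

Σ𝒫[_]_ : ∀ {n} → (Subset n → Bool) → (Subset n → ℚ) → ℚ
Σ𝒫[_]_ {n} P H = sumL (allSubsets n) (λ w → if P w then H w else 0ℚ)

Σ𝒫[]-suc : ∀ {n} (P : Subset (suc n) → Bool) H →
  Σ𝒫[ P ] H ≡ Σ𝒫[ (λ w → P (outside ∷ w)) ] (λ w → H (outside ∷ w))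
              ℚ.+ Σ𝒫[ (λ w → P (inside ∷ w)) ] (λ w → H (inside ∷ w))
Σ𝒫[]-suc {n} P H = trans (sumL-++ (map (outside ∷_) (allSubsets n)) _ F)
  (cong₂ ℚ._+_ (sumL-map (outside ∷_) (allSubsets n) F) (sumL-map (inside ∷_) (allSubsets n) F))
  where F = λ w → if P w then H w else 0ℚ

Σ𝒫[]-never : ∀ {n} (P : Subset n → Bool) H → (∀ w → P w ≡ false) → Σ𝒫[ P ] H ≡ 0ℚ
Σ𝒫[]-never {n} P H P≡false = trans (sumL-cong (allSubsets n) (λ w → cong (λ b → if b then H w else 0ℚ) (P≡false w)))
                                   (sumL-zero (allSubsets n))

Σ𝒫[]-outside : ∀ {n} (P : Subset (suc n) → Bool) H → (∀ w → P (inside ∷ w) ≡ false) →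
  Σ𝒫[ P ] H ≡ Σ𝒫[ (λ w → P (outside ∷ w)) ] (λ w → H (outside ∷ w))
Σ𝒫[]-outside P H P≡false = trans (Σ𝒫[]-suc P H)
  (trans (cong (Σ𝒫[ (λ w → P (outside ∷ w)) ] (λ w → H (outside ∷ w)) ℚ.+_)
               (Σ𝒫[]-never (λ w → P (inside ∷ w)) (λ w → H (inside ∷ w)) P≡false))
         (ℚP.+-identityʳ _))

Σ𝒫[]-inside : ∀ {n} (P : Subset (suc n) → Bool) H → (∀ w → P (outside ∷ w) ≡ false) →
  Σ𝒫[ P ] H ≡ Σ𝒫[ (λ w → P (inside ∷ w)) ] (λ w → H (inside ∷ w))
Σ𝒫[]-inside P H P≡false = trans (Σ𝒫[]-suc P H)
  (trans (cong (ℚ._+ Σ𝒫[ (λ w → P (inside ∷ w)) ] (λ w → H (inside ∷ w)))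
               (Σ𝒫[]-never (λ w → P (outside ∷ w)) (λ w → H (outside ∷ w)) P≡false))
         (ℚP.+-identityˡ _))

Σ𝒫-⊆-equicard : ∀ n (z : Subset n) (H : Subset n → ℚ) → Σ𝒫[ (_⊆[ 0 ] z) ] H ≡ H z
Σ𝒫-⊆-equicard zero    []            H = ℚP.+-identityʳ (H [])
Σ𝒫-⊆-equicard (suc n) (outside ∷ z) H =
  trans (Σ𝒫[]-outside (_⊆[ 0 ] (outside ∷ z)) H (λ _ → refl))
        (Σ𝒫-⊆-equicard n z (λ w → H (outside ∷ w)))
Σ𝒫-⊆-equicard (suc n) (inside ∷ z)  H =
  trans (Σ𝒫[]-inside (_⊆[ 0 ] (inside ∷ z)) H (λ w → ⊆∧≡ᵇsuc≡false w z))
        (Σ𝒫-⊆-equicard n z (λ w → H (inside ∷ w)))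

Σ𝒫-⊇-equicard : ∀ n (z : Subset n) (H : Subset n → ℚ) → Σ𝒫[ (z ⊆[ 0 ]_) ] H ≡ H z
Σ𝒫-⊇-equicard zero    []            H = ℚP.+-identityʳ (H [])
Σ𝒫-⊇-equicard (suc n) (outside ∷ z) H =
  trans (Σ𝒫[]-outside ((outside ∷ z) ⊆[ 0 ]_) H (λ w → ⊆∧≡ᵇsuc≡false z w))
        (Σ𝒫-⊇-equicard n z (λ w → H (outside ∷ w)))
Σ𝒫-⊇-equicard (suc n) (inside ∷ z)  H =
  trans (Σ𝒫[]-inside ((inside ∷ z) ⊆[ 0 ]_) H (λ _ → refl))
        (Σ𝒫-⊇-equicard n z (λ w → H (inside ∷ w)))

Σ∈ : ∀ {n} → Subset n → (Fin n → ℚ) → ℚ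
Σ∈ []            f = 0ℚ
Σ∈ (outside ∷ S) f = Σ∈ S (λ e → f (suc e))
Σ∈ (inside ∷ S)  f = f zero ℚ.+ Σ∈ S (λ e → f (suc e))

Σ𝒫-⊆-codim1 : ∀ n (z : Subset n) (H : Subset n → ℚ) →
  Σ𝒫[ (_⊆[ 1 ] z) ] H ≡ Σ∈ z (λ e → H (z [ e ]≔ outside))
Σ𝒫-⊆-codim1 zero    []            H = ℚP.+-identityʳ 0ℚ
Σ𝒫-⊆-codim1 (suc n) (outside ∷ z) H =
  trans (Σ𝒫[]-outside (_⊆[ 1 ] (outside ∷ z)) H (λ _ → refl))
        (Σ𝒫-⊆-codim1 n z (λ w → H (outside ∷ w)))
Σ𝒫-⊆-codim1 (suc n) (inside ∷ z)  H =
  trans (Σ𝒫[]-suc (_⊆[ 1 ] (inside ∷ z)) H)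
        (cong₂ ℚ._+_ (Σ𝒫-⊆-equicard n z (λ w → H (outside ∷ w)))
                     (Σ𝒫-⊆-codim1 n z (λ w → H (inside ∷ w))))

Σ𝒫-⊇-codim1 : ∀ n (z : Subset n) (H : Subset n → ℚ) →
  Σ𝒫[ (z ⊆[ 1 ]_) ] H ≡ Σ∈ (∁ z) (λ e → H (z [ e ]≔ inside))
Σ𝒫-⊇-codim1 zero    []            H = ℚP.+-identityʳ 0ℚ
Σ𝒫-⊇-codim1 (suc n) (outside ∷ z) H =
  trans (Σ𝒫[]-suc ((outside ∷ z) ⊆[ 1 ]_) H)
        (trans (cong₂ ℚ._+_ (Σ𝒫-⊇-codim1 n z (λ w → H (outside ∷ w)))
                            (Σ𝒫-⊇-equicard n z (λ w → H (inside ∷ w))))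
               (ℚP.+-comm _ (H (inside ∷ z))))
Σ𝒫-⊇-codim1 (suc n) (inside ∷ z)  H =
  trans (Σ𝒫[]-inside ((inside ∷ z) ⊆[ 1 ]_) H (λ _ → refl))
        (Σ𝒫-⊇-codim1 n z (λ w → H (inside ∷ w)))

Σ∈-cong : ∀ {n} (S : Subset n) {f g : Fin n → ℚ} → (∀ e → lookup S e ≡ true → f e ≡ g e) →
  Σ∈ S f ≡ Σ∈ S g
Σ∈-cong []            f≗g = refl
Σ∈-cong (outside ∷ S) f≗g = Σ∈-cong S (λ e → f≗g (suc e))
Σ∈-cong (inside ∷ S)  f≗g = cong₂ ℚ._+_ (f≗g zero refl) (Σ∈-cong S (λ e → f≗g (suc e)))

Σ∈-∩ : ∀ {n} (S T : Subset n) (f : Fin n → ℚ) →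
  Σ∈ S (λ e → if lookup T e then f e else 0ℚ) ≡ Σ∈ (S ∩ T) f
Σ∈-∩ []            []            f = refl
Σ∈-∩ (outside ∷ S) (_ ∷ T)       f = Σ∈-∩ S T (λ e → f (suc e))
Σ∈-∩ (inside ∷ S)  (inside ∷ T)  f = cong (f zero ℚ.+_) (Σ∈-∩ S T (λ e → f (suc e)))
Σ∈-∩ (inside ∷ S)  (outside ∷ T) f = trans (ℚP.+-identityˡ _) (Σ∈-∩ S T (λ e → f (suc e)))

Σ∈-count : ∀ {n} (S y : Subset n) (h : Bool → ℕ) →
  Σ∈ S (λ e → ℕtoℚ (h (lookup y e))) ≡ ℕtoℚ (∣ S ∩ y ∣ * h true + ∣ S ∩ ∁ y ∣ * h false)
Σ∈-count []            []           h = refl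
Σ∈-count (outside ∷ S) (_ ∷ y)      h = Σ∈-count S y h
Σ∈-count (inside ∷ S)  (inside ∷ y) h = begin
  ℕtoℚ (h true) ℚ.+ Σ∈ S (λ e → ℕtoℚ (h (lookup y e)))   ≡⟨ cong (ℕtoℚ (h true) ℚ.+_) (Σ∈-count S y h) ⟩
  ℕtoℚ (h true) ℚ.+ ℕtoℚ (a * h true + b * h false)      ≡⟨ ℕtoℚ-+ (h true) _ ⟨
  ℕtoℚ (h true + (a * h true + b * h false))             ≡⟨ cong ℕtoℚ (ℕP.+-assoc (h true) _ _) ⟨
  ℕtoℚ (suc a * h true + b * h false)                    ∎
  where
  open ≡-Reasoning
  a = ∣ S ∩ y ∣
  b = ∣ S ∩ ∁ y ∣
Σ∈-count (inside ∷ S)  (outside ∷ y) h = begin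
  ℕtoℚ (h false) ℚ.+ Σ∈ S (λ e → ℕtoℚ (h (lookup y e)))  ≡⟨ cong (ℕtoℚ (h false) ℚ.+_) (Σ∈-count S y h) ⟩
  ℕtoℚ (h false) ℚ.+ ℕtoℚ (a * h true + b * h false)     ≡⟨ ℕtoℚ-+ (h false) _ ⟨
  ℕtoℚ (h false + (a * h true + b * h false))            ≡⟨ cong ℕtoℚ (x+[y+z]≡y+[x+z] (h false) (a * h true) (b * h false)) ⟩
  ℕtoℚ (a * h true + suc b * h false)                    ∎
  where
  open ≡-Reasoning
  a = ∣ S ∩ y ∣
  b = ∣ S ∩ ∁ y ∣

-- Blocks of the Terwilliger algebra

module Blocks (n m : ℕ) (x : Subset n) where

  A : Mat n
  A = adjJ n m

  E* : ℕ → Mat n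
  E* = Estar n m x

  Γ : ℕ → Subset n → Bool
  Γ = inΓ n m x

  _⊙_ : Mat n → Mat n → Mat n
  _⊙_ = matMul n m

  Block : ℕ → ℕ → Mat n → Set
  Block = InTblock n m x

  Γ-level : ∀ b g v → Γ (⟦ b ⟧ + 2 * g) v ≡ (∣ v ∣ ≡ᵇ ⟦ b ⟧ + m) ∧ (∣ v ∩ x ∣ + g ≡ᵇ m)
  Γ-level b g v rewrite [⟦b⟧+2g]%2≡⟦b⟧ b g | [⟦b⟧+2g]/2≡g b g | ∩-comm x v with b
  ... | true  = refl
  ... | false = refl

  Γ⁺ : ∀ b g {v} → ∣ v ∣ ≡ ⟦ b ⟧ + m → ∣ v ∩ x ∣ + g ≡ m → Γ (⟦ b ⟧ + 2 * g) v ≡ true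
  Γ⁺ b g {v} ∣v∣≡ ∣v∩x∣≡ = trans (Γ-level b g v) (cong₂ _∧_ (≡ᵇ-true ∣v∣≡) (≡ᵇ-true ∣v∩x∣≡))

  Γ⁻ : ∀ b g {v} → Γ (⟦ b ⟧ + 2 * g) v ≡ true → ∣ v ∣ ≡ ⟦ b ⟧ + m × ∣ v ∩ x ∣ + g ≡ m
  Γ⁻ b g {v} v∈Γ = ≡ᵇ-sound (∧-true-left v∈Γ′) , ≡ᵇ-sound (∧-true-right v∈Γ′)
    where v∈Γ′ = trans (sym (Γ-level b g v)) v∈Γ

  Γ-off : ∀ b g {v} → ∣ v ∩ x ∣ + g ≢ m → Γ (⟦ b ⟧ + 2 * g) v ≡ false
  Γ-off b g {v} ∣v∩x∣≢ =
    trans (Γ-level b g v) (trans (cong ((∣ v ∣ ≡ᵇ ⟦ b ⟧ + m) ∧_) (≡ᵇ-false ∣v∩x∣≢)) (∧-zeroʳ _))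

  inX-level : ∀ b v → ∣ v ∣ ≡ ⟦ b ⟧ + m → inX n m v ≡ true
  inX-level true  v ∣v∣≡ rewrite ∣v∣≡ | ≡ᵇ-true {m} refl = cong (_∨ true) (≡ᵇ-false {suc m} ℕP.1+n≢n)
  inX-level false v ∣v∣≡ rewrite ∣v∣≡ | ≡ᵇ-true {m} refl = refl

  E*-entry : ∀ j v w → E* j v w ≡ boolℚ ((Γ j v ∧ Γ j w) ∧ (w ⊆[ 0 ] v))
  E*-entry j v w = begin
    boolℚ (Γ j v ∧ Γ j w ∧ ⌊ v ⊆? w ⌋ ∧ ⌊ w ⊆? v ⌋)          ≡⟨ cong (λ c → boolℚ (Γ j v ∧ Γ j w ∧ c)) ⌊⊆⌋∧⌊⊇⌋≡ ⟩
    boolℚ (Γ j v ∧ Γ j w ∧ (w ⊆[ 0 ] v))                     ≡⟨ cong boolℚ (∧-assoc (Γ j v) (Γ j w) _) ⟨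
    boolℚ ((Γ j v ∧ Γ j w) ∧ (w ⊆[ 0 ] v))                   ∎
    where
    open ≡-Reasoning
    ⌊⊆⌋∧⌊⊇⌋≡ : ⌊ v ⊆? w ⌋ ∧ ⌊ w ⊆? v ⌋ ≡ w ⊆[ 0 ] v
    ⌊⊆⌋∧⌊⊇⌋≡ = trans (cong₂ _∧_ (isYes≗does (v ⊆? w)) (isYes≗does (w ⊆? v))) (⊆∧⊇≡⊆[0] v w)

  ⊙E*-entry : ∀ M j y w → inX n m w ≡ true → (M ⊙ E* j) y w ≡ boolℚ (Γ j w) ℚ.* M y w
  ⊙E*-entry M j y w w∈X = begin
    (M ⊙ E* j) y w
      ≡⟨ sumL-filterᵇ (inX n m) (allSubsets n) (λ v → M y v ℚ.* E* j v w) ⟩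
    Σ𝒫[ inX n m ] (λ v → M y v ℚ.* E* j v w)
      ≡⟨ sumL-cong (allSubsets n) (λ v → trans (cong (λ q → if inX n m v then M y v ℚ.* q else 0ℚ) (E*-entry j v w))
                                               (if-then-*boolℚ-∧ (inX n m v) (w ⊆[ 0 ] v) (M y v) _)) ⟩
    Σ𝒫[ (w ⊆[ 0 ]_) ] (λ v → if inX n m v then M y v ℚ.* boolℚ (Γ j v ∧ Γ j w) else 0ℚ)
      ≡⟨ Σ𝒫-⊇-equicard n w _ ⟩
    (if inX n m w then M y w ℚ.* boolℚ (Γ j w ∧ Γ j w) else 0ℚ)
      ≡⟨ cong (λ p → if p then M y w ℚ.* boolℚ (Γ j w ∧ Γ j w) else 0ℚ) w∈X ⟩
    M y w ℚ.* boolℚ (Γ j w ∧ Γ j w)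
      ≡⟨ trans (cong (λ b → M y w ℚ.* boolℚ b) (∧-idem (Γ j w))) (ℚP.*-comm (M y w) _) ⟩
    boolℚ (Γ j w) ℚ.* M y w ∎
    where open ≡-Reasoning

  A-entry-down : ∀ w {z} → ∣ z ∣ ≡ suc m → A w z ≡ boolℚ (w ⊆[ 1 ] z)
  A-entry-down w {z} ∣z∣≡ rewrite ∣z∣≡ | ≡ᵇ-true {m} refl | ≡ᵇ-false {suc m} {m} ℕP.1+n≢n =
    cong boolℚ (trans (∨-identityʳ _)
                      (trans (cong ((∣ w ∣ ≡ᵇ m) ∧_) (isYes≗does (w ⊆? z))) (∧-comm (∣ w ∣ ≡ᵇ m) _)))

  A-entry-up : ∀ w {z} → ∣ z ∣ ≡ m → A w z ≡ boolℚ (z ⊆[ 1 ] w)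
  A-entry-up w {z} ∣z∣≡ rewrite ∣z∣≡ | ≡ᵇ-true {m} refl | ≡ᵇ-false {m} {suc m} (λ eq → ℕP.1+n≢n (sym eq)) =
    cong boolℚ (begin
      ((∣ w ∣ ≡ᵇ m) ∧ false) ∨ ((∣ w ∣ ≡ᵇ suc m) ∧ ⌊ z ⊆? w ⌋)  ≡⟨ cong (_∨ ((∣ w ∣ ≡ᵇ suc m) ∧ ⌊ z ⊆? w ⌋)) (∧-zeroʳ (∣ w ∣ ≡ᵇ m)) ⟩
      (∣ w ∣ ≡ᵇ suc m) ∧ ⌊ z ⊆? w ⌋                             ≡⟨ cong₂ _∧_ (≡ᵇ-comm ∣ w ∣ (suc m)) (isYes≗does (z ⊆? w)) ⟩
      (suc m ≡ᵇ ∣ w ∣) ∧ does (z ⊆? w)                          ≡⟨ ∧-comm (suc m ≡ᵇ ∣ w ∣) _ ⟩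
      does (z ⊆? w) ∧ (suc m ≡ᵇ ∣ w ∣)                          ∎)
    where open ≡-Reasoning

  ⊙E*⊙A≡Σ𝒫 : ∀ M j y z (c : Subset n → Bool) → (∀ w → A w z ≡ boolℚ (c w)) →
    (∀ w → c w ≡ true → inX n m w ≡ true) →
    ((M ⊙ E* j) ⊙ A) y z ≡ Σ𝒫[ c ] (λ w → boolℚ (Γ j w) ℚ.* M y w)
  ⊙E*⊙A≡Σ𝒫 M j y z c A≡c c⇒X = trans (sumL-filterᵇ (inX n m) (allSubsets n) _) (sumL-cong (allSubsets n) term)
    where
    term : ∀ w → (if inX n m w then (M ⊙ E* j) y w ℚ.* A w z else 0ℚ)
               ≡ (if c w then boolℚ (Γ j w) ℚ.* M y w else 0ℚ)
    term w rewrite A≡c w with c w in cw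
    ... | true  rewrite c⇒X w cw = trans (ℚP.*-identityʳ _) (⊙E*-entry M j y w (c⇒X w cw))
    ... | false with inX n m w
    ...   | true  = ℚP.*-zeroʳ ((M ⊙ E* j) y w)
    ...   | false = refl

  ⊙E*⊙A-down : ∀ M j y {z} → ∣ z ∣ ≡ suc m →
    ((M ⊙ E* j) ⊙ A) y z ≡ Σ∈ z (λ e → boolℚ (Γ j (z [ e ]≔ outside)) ℚ.* M y (z [ e ]≔ outside))
  ⊙E*⊙A-down M j y {z} ∣z∣≡ =
    trans (⊙E*⊙A≡Σ𝒫 M j y z (_⊆[ 1 ] z) (λ w → A-entry-down w ∣z∣≡) ⊆⇒X) (Σ𝒫-⊆-codim1 n z _)
    where
    ⊆⇒X : ∀ w → w ⊆[ 1 ] z ≡ true → inX n m w ≡ true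
    ⊆⇒X w w⊆z = inX-level false w (ℕP.suc-injective (trans (≡ᵇ-sound (∧-true-right w⊆z)) ∣z∣≡))

  ⊙E*⊙A-up : ∀ M j y {z} → ∣ z ∣ ≡ m →
    ((M ⊙ E* j) ⊙ A) y z ≡ Σ∈ (∁ z) (λ e → boolℚ (Γ j (z [ e ]≔ inside)) ℚ.* M y (z [ e ]≔ inside))
  ⊙E*⊙A-up M j y {z} ∣z∣≡ =
    trans (⊙E*⊙A≡Σ𝒫 M j y z (z ⊆[ 1 ]_) (λ w → A-entry-up w ∣z∣≡) ⊇⇒X) (Σ𝒫-⊇-codim1 n z _)
    where
    ⊇⇒X : ∀ w → z ⊆[ 1 ] w ≡ true → inX n m w ≡ true
    ⊇⇒X w z⊆w = inX-level true w (trans (sym (≡ᵇ-sound (∧-true-right z⊆w))) (cong suc ∣z∣≡))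

  inner outer : Subset n → Subset n → ℕ
  inner y z = ∣ z ∩ (x ∩ y) ∣
  outer y z = ∣ z ∩ (∁ x ∩ y) ∣

  kronC-entry : ∀ l s y z → kronC n x l s y z ≡ ℕtoℚ ((inner y z C l) * (outer y z C s))
  kronC-entry l s y z = cong₂ (λ a b → ℕtoℚ ((∣ a ∣ C l) * (∣ b ∣ C s)))
    ([p∩r]∩[q∩r]≡q∩[r∩p] y z x)
    (trans (cong₂ _∩_ (p─q≡p∩∁q y x) (p─q≡p∩∁q z x)) ([p∩r]∩[q∩r]≡q∩[r∩p] y z (∁ x)))

  lookup-x∩ : ∀ y e → lookup (x ∩ y) e ≡ lookup x e ∧ lookup y e
  lookup-x∩ y e = VecP.lookup-zipWith _∧_ e x y

  lookup-∁x∩ : ∀ y e → lookup (∁ x ∩ y) e ≡ not (lookup x e) ∧ lookup y e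
  lookup-∁x∩ y e = trans (VecP.lookup-zipWith _∧_ e (∁ x) y) (cong (_∧ lookup y e) (VecP.lookup-map e not x))

  inner≤∣z∩x∣ : ∀ y z → inner y z ≤ ∣ z ∩ x ∣
  inner≤∣z∩x∣ y z = subst (_≤ ∣ z ∩ x ∣) (cong ∣_∣ (∩-assoc z x y)) (∣p∩q∣≤∣p∣ (z ∩ x) y)

  outer≤∣z∩∁x∣ : ∀ y z → outer y z ≤ ∣ z ∩ ∁ x ∣
  outer≤∣z∩∁x∣ y z = subst (_≤ ∣ z ∩ ∁ x ∣) (cong ∣_∣ (∩-assoc z (∁ x) y)) (∣p∩q∣≤∣p∣ (z ∩ ∁ x) y)

  ∣z∩y∣≡inner+outer : ∀ y z → ∣ z ∩ y ∣ ≡ inner y z + outer y z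
  ∣z∩y∣≡inner+outer y z = begin
    ∣ z ∩ y ∣                                   ≡⟨ ∣p∩q∣+∣p∩∁q∣≡∣p∣ (z ∩ y) x ⟨
    ∣ (z ∩ y) ∩ x ∣ + ∣ (z ∩ y) ∩ ∁ x ∣         ≡⟨ cong₂ (λ p q → ∣ p ∣ + ∣ q ∣) (swap x) (swap (∁ x)) ⟩
    inner y z + outer y z                       ∎
    where
    open ≡-Reasoning
    swap : ∀ c → (z ∩ y) ∩ c ≡ z ∩ (c ∩ y)
    swap c = trans (∩-assoc z y c) (cong (z ∩_) (∩-comm y c))

  Agrees : ℕ → ℕ → Mat n → Mat n → Set
  Agrees i j M P = ∀ y z → Γ i y ≡ true → Γ j z ≡ true → M y z ≡ P y z

  block-from-multiple : ∀ {i j M} k (P : Mat n) → InT n m x M →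
    Agrees i j M (λ y z → ℕtoℚ (suc k) ℚ.* P y z) → Block i j P
  block-from-multiple {M = M} k P M∈T M≈ =
    1/suc k · M , scale (1/suc k) M∈T ,
    λ y z y∈ z∈ → trans (cong (1/suc k ℚ.*_) (M≈ y z y∈ z∈)) (1/suc-cancel k (P y z))

  term-on-level : ∀ i j l s M y w → Agrees i j M (kronC n x l s) → Γ i y ≡ true → Γ j w ≡ true →
    boolℚ (Γ j w) ℚ.* M y w ≡ ℕtoℚ ((inner y w C l) * (outer y w C s))
  term-on-level i j l s M y w M≈ y∈ w∈ = begin
    boolℚ (Γ j w) ℚ.* M y w   ≡⟨ cong (λ b → boolℚ b ℚ.* M y w) w∈ ⟩
    1ℚ ℚ.* M y w              ≡⟨ ℚP.*-identityˡ (M y w) ⟩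
    M y w                     ≡⟨ M≈ y w y∈ w∈ ⟩
    kronC n x l s y w         ≡⟨ kronC-entry l s y w ⟩
    ℕtoℚ ((inner y w C l) * (outer y w C s)) ∎
    where open ≡-Reasoning

  removal-term : ∀ {i g s M} → Agrees i (2 * g) M (kronC n x (m ∸ g) s) →
    ∀ {y z e} → Γ i y ≡ true → ∣ z ∣ ≡ suc m → ∣ z ∩ x ∣ + g ≡ m → lookup z e ≡ true →
    boolℚ (Γ (2 * g) (z [ e ]≔ outside)) ℚ.* M y (z [ e ]≔ outside)
    ≡ (if lookup (∁ x) e then ℕtoℚ ((inner y z C (m ∸ g)) * ((outer y z ∸ ⟦ lookup y e ⟧) C s)) else 0ℚ)
  removal-term {i} {g} {s} {M} M≈ {y} {z} {e} y∈ ∣z∣≡ ∣z∩x∣+g≡ e∈z =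
    trans (by-x (lookup x e) refl) (cong (λ b → if b then V else 0ℚ) (sym (VecP.lookup-map e not x)))
    where
    w = z [ e ]≔ outside
    V = ℕtoℚ ((inner y z C (m ∸ g)) * ((outer y z ∸ ⟦ lookup y e ⟧) C s))
    by-x : ∀ b → lookup x e ≡ b → boolℚ (Γ (2 * g) w) ℚ.* M y w ≡ (if not b then V else 0ℚ)
    by-x true e∈x = trans (cong (λ b → boolℚ b ℚ.* M y w) (Γ-off false g w-off)) (ℚP.*-zeroˡ (M y w))
      where
      open ≡-Reasoning
      w-off : ∣ w ∩ x ∣ + g ≢ m
      w-off eq = ℕP.1+n≢n (begin
        suc m                            ≡⟨ cong suc eq ⟨
        suc (∣ w ∩ x ∣ + g)              ≡⟨ cong (λ b → ⟦ b ⟧ + ∣ w ∩ x ∣ + g) e∈x ⟨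
        ⟦ lookup x e ⟧ + ∣ w ∩ x ∣ + g   ≡⟨ cong (_+ g) (∣p∩q∣-remove z e e∈z x) ⟨
        ∣ z ∩ x ∣ + g                    ≡⟨ ∣z∩x∣+g≡ ⟩
        m                                ∎)
    by-x false e∉x = trans (term-on-level i (2 * g) (m ∸ g) s M y w M≈ y∈ w∈Γ)
                               (cong₂ (λ a b → ℕtoℚ ((a C (m ∸ g)) * (b C s))) inner-w outer-w)
      where
      ∣w∩x∣≡ : ∣ w ∩ x ∣ ≡ ∣ z ∩ x ∣
      ∣w∩x∣≡ = sym (trans (∣p∩q∣-remove z e e∈z x) (cong (λ b → ⟦ b ⟧ + ∣ w ∩ x ∣) e∉x))
      w∈Γ : Γ (2 * g) w ≡ true
      w∈Γ = Γ⁺ false g (ℕP.suc-injective (trans (sym (∣p∣-remove z e e∈z)) ∣z∣≡))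
                       (trans (cong (_+ g) ∣w∩x∣≡) ∣z∩x∣+g≡)
      inner-w : inner y w ≡ inner y z
      inner-w = sym (trans (∣p∩q∣-remove z e e∈z (x ∩ y))
                           (cong (λ b → ⟦ b ⟧ + inner y w) (trans (lookup-x∩ y e) (cong (_∧ lookup y e) e∉x))))
      outer-z : outer y z ≡ ⟦ lookup y e ⟧ + outer y w
      outer-z = trans (∣p∩q∣-remove z e e∈z (∁ x ∩ y))
                      (cong (λ b → ⟦ b ⟧ + outer y w) (trans (lookup-∁x∩ y e) (cong (λ b → not b ∧ lookup y e) e∉x)))
      outer-w : outer y w ≡ outer y z ∸ ⟦ lookup y e ⟧
      outer-w = trans (sym (ℕP.m+n∸m≡n ⟦ lookup y e ⟧ (outer y w))) (cong (_∸ ⟦ lookup y e ⟧) (sym outer-z))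

  odd-from-even : ∀ {i g s} → 2 * g ≤ 2 * m + 1 → s ≤ g →
    Block i (2 * g) (kronC n x (m ∸ g) s) → Block i (suc (2 * g)) (kronC n x (m ∸ g) s)
  odd-from-even {i} {g} {s} 2g≤ s≤g (M , M∈T , M≈) =
    block-from-multiple {i} {suc (2 * g)} (g ∸ s) (kronC n x (m ∸ g) s) (mul (mul M∈T (genE (2 * g) 2g≤)) genA) entries
    where
    entries : Agrees i (suc (2 * g)) ((M ⊙ E* (2 * g)) ⊙ A)
                     (λ y z → ℕtoℚ (suc (g ∸ s)) ℚ.* kronC n x (m ∸ g) s y z)
    entries y z y∈ z∈ = begin
      ((M ⊙ E* (2 * g)) ⊙ A) y z
        ≡⟨ ⊙E*⊙A-down M (2 * g) y ∣z∣≡ ⟩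
      Σ∈ z (λ e → boolℚ (Γ (2 * g) (z [ e ]≔ outside)) ℚ.* M y (z [ e ]≔ outside))
        ≡⟨ Σ∈-cong z (λ e → removal-term {i} {g} {s} M≈ y∈ ∣z∣≡ ∣z∩x∣+g≡) ⟩
      Σ∈ z (λ e → if lookup (∁ x) e then ℕtoℚ (h (lookup y e)) else 0ℚ)
        ≡⟨ Σ∈-∩ z (∁ x) _ ⟩
      Σ∈ (z ∩ ∁ x) (λ e → ℕtoℚ (h (lookup y e)))
        ≡⟨ Σ∈-count (z ∩ ∁ x) y h ⟩
      ℕtoℚ (c₁ * h true + c₂ * h false)
        ≡⟨ cong ℕtoℚ count ⟩
      ℕtoℚ (suc (g ∸ s) * (X * (r C s)))
        ≡⟨ ℕtoℚ-* (suc (g ∸ s)) (X * (r C s)) ⟩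
      ℕtoℚ (suc (g ∸ s)) ℚ.* ℕtoℚ (X * (r C s))
        ≡⟨ cong (ℕtoℚ (suc (g ∸ s)) ℚ.*_) (kronC-entry (m ∸ g) s y z) ⟨
      ℕtoℚ (suc (g ∸ s)) ℚ.* kronC n x (m ∸ g) s y z ∎
      where
      open ≡-Reasoning
      ∣z∣≡ = proj₁ (Γ⁻ true g z∈)
      ∣z∩x∣+g≡ = proj₂ (Γ⁻ true g z∈)
      X = inner y z C (m ∸ g)
      r = outer y z
      h : Bool → ℕ
      h b = X * ((r ∸ ⟦ b ⟧) C s)
      c₁ = ∣ (z ∩ ∁ x) ∩ y ∣
      c₂ = ∣ (z ∩ ∁ x) ∩ ∁ y ∣
      c₁≡r : c₁ ≡ r
      c₁≡r = cong ∣_∣ (∩-assoc z (∁ x) y)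
      c₂+r≡ : c₂ + r ≡ suc g
      c₂+r≡ = trans (trans (ℕP.+-comm c₂ r) (cong (_+ c₂) (sym c₁≡r)))
                    (trans (∣p∩q∣+∣p∩∁q∣≡∣p∣ (z ∩ ∁ x) y) (∣p∩∁q∣≡ z x 1 ∣z∣≡ ∣z∩x∣+g≡))
      count : c₁ * h true + c₂ * h false ≡ suc (g ∸ s) * (X * (r C s))
      count = begin
        c₁ * (X * ((r ∸ 1) C s)) + c₂ * (X * (r C s))   ≡⟨ factor c₁ c₂ X ((r ∸ 1) C s) (r C s) ⟩
        X * (c₁ * ((r ∸ 1) C s) + c₂ * (r C s))         ≡⟨ cong (λ c → X * (c * ((r ∸ 1) C s) + c₂ * (r C s))) c₁≡r ⟩
        X * (r * ((r ∸ 1) C s) + c₂ * (r C s))          ≡⟨ cong (X *_) (n*[n∸1]Ck+q*nCk≡[q+n∸k]*nCk r c₂ s) ⟩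
        X * ((c₂ + r ∸ s) * (r C s))                    ≡⟨ cong (λ c → X * ((c ∸ s) * (r C s))) c₂+r≡ ⟩
        X * ((suc g ∸ s) * (r C s))                     ≡⟨ cong (λ c → X * (c * (r C s))) (ℕP.+-∸-assoc 1 s≤g) ⟩
        X * (suc (g ∸ s) * (r C s))                     ≡⟨ x*[y*z]≡y*[x*z] X (suc (g ∸ s)) (r C s) ⟩
        suc (g ∸ s) * (X * (r C s))                     ∎
        where
        factor : ∀ a b c p q → a * (c * p) + b * (c * q) ≡ c * (a * p + b * q)
        factor = solve-∀

  insertion-in-term : ∀ {i g s M} → Agrees i (suc (2 * g)) M (kronC n x (m ∸ g) s) →
    ∀ {y z e} → Γ i y ≡ true → ∣ z ∣ ≡ m → ∣ z ∩ x ∣ + suc g ≡ m → lookup (∁ z) e ≡ true →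
    boolℚ (Γ (suc (2 * g)) (z [ e ]≔ inside)) ℚ.* M y (z [ e ]≔ inside)
    ≡ (if lookup x e then ℕtoℚ (((⟦ lookup y e ⟧ + inner y z) C (m ∸ g)) * (outer y z C s)) else 0ℚ)
  insertion-in-term {i} {g} {s} {M} M≈ {y} {z} {e} y∈ ∣z∣≡ ∣z∩x∣+1+g≡ e∈∁z = by-x (lookup x e) refl
    where
    w = z [ e ]≔ inside
    e∉z = ∈∁⇒∉ {p = z} {e} e∈∁z
    V = ℕtoℚ (((⟦ lookup y e ⟧ + inner y z) C (m ∸ g)) * (outer y z C s))
    by-x : ∀ b → lookup x e ≡ b → boolℚ (Γ (suc (2 * g)) w) ℚ.* M y w ≡ (if b then V else 0ℚ)
    by-x false e∉x = trans (cong (λ b → boolℚ b ℚ.* M y w) (Γ-off true g w-off)) (ℚP.*-zeroˡ (M y w))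
      where
      open ≡-Reasoning
      w-off : ∣ w ∩ x ∣ + g ≢ m
      w-off eq = ℕP.1+n≢n (begin
        suc m                              ≡⟨ cong suc eq ⟨
        suc (∣ w ∩ x ∣ + g)                ≡⟨ ℕP.+-suc ∣ w ∩ x ∣ g ⟨
        ∣ w ∩ x ∣ + suc g                  ≡⟨ cong (_+ suc g) (∣p∩q∣-insert z e e∉z x) ⟩
        ⟦ lookup x e ⟧ + ∣ z ∩ x ∣ + suc g ≡⟨ cong (λ b → ⟦ b ⟧ + ∣ z ∩ x ∣ + suc g) e∉x ⟩
        ∣ z ∩ x ∣ + suc g                  ≡⟨ ∣z∩x∣+1+g≡ ⟩
        m                                  ∎)
    by-x true e∈x = trans (term-on-level i (suc (2 * g)) (m ∸ g) s M y w M≈ y∈ w∈Γ)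
                               (cong₂ (λ a b → ℕtoℚ ((a C (m ∸ g)) * (b C s))) inner-w outer-w)
      where
      ∣w∩x∣≡ : ∣ w ∩ x ∣ ≡ suc ∣ z ∩ x ∣
      ∣w∩x∣≡ = trans (∣p∩q∣-insert z e e∉z x) (cong (λ b → ⟦ b ⟧ + ∣ z ∩ x ∣) e∈x)
      w∈Γ : Γ (suc (2 * g)) w ≡ true
      w∈Γ = Γ⁺ true g (trans (∣p∣-insert z e e∉z) (cong suc ∣z∣≡))
                      (trans (cong (_+ g) ∣w∩x∣≡) (trans (sym (ℕP.+-suc ∣ z ∩ x ∣ g)) ∣z∩x∣+1+g≡))
      inner-w : inner y w ≡ ⟦ lookup y e ⟧ + inner y z
      inner-w = trans (∣p∩q∣-insert z e e∉z (x ∩ y))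
                      (cong (λ b → ⟦ b ⟧ + inner y z) (trans (lookup-x∩ y e) (cong (_∧ lookup y e) e∈x)))
      outer-w : outer y w ≡ outer y z
      outer-w = trans (∣p∩q∣-insert z e e∉z (∁ x ∩ y))
                      (cong (λ b → ⟦ b ⟧ + outer y z) (trans (lookup-∁x∩ y e) (cong (λ b → not b ∧ lookup y e) e∈x)))

  even-from-odd : ∀ {u g s} → suc (2 * g) ≤ 2 * m + 1 → u ≤ g → suc g ≤ m →
    Block (2 * u) (suc (2 * g)) (kronC n x (m ∸ g) s) → Block (2 * u) (2 * suc g) (kronC n x (m ∸ suc g) s)
  even-from-odd {u} {g} {s} 1+2g≤ u≤g 1+g≤m (M , M∈T , M≈) =
    block-from-multiple {2 * u} {2 * suc g} (g ∸ u) (kronC n x (m ∸ suc g) s)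
      (mul (mul M∈T (genE (suc (2 * g)) 1+2g≤)) genA) entries
    where
    entries : Agrees (2 * u) (2 * suc g) ((M ⊙ E* (suc (2 * g))) ⊙ A)
                     (λ y z → ℕtoℚ (suc (g ∸ u)) ℚ.* kronC n x (m ∸ suc g) s y z)
    entries y z y∈ z∈ = begin
      ((M ⊙ E* (suc (2 * g))) ⊙ A) y z
        ≡⟨ ⊙E*⊙A-up M (suc (2 * g)) y ∣z∣≡ ⟩
      Σ∈ (∁ z) (λ e → boolℚ (Γ (suc (2 * g)) (z [ e ]≔ inside)) ℚ.* M y (z [ e ]≔ inside))
        ≡⟨ Σ∈-cong (∁ z) (λ e → insertion-in-term {2 * u} {g} {s} M≈ y∈ ∣z∣≡ ∣z∩x∣+1+g≡) ⟩
      Σ∈ (∁ z) (λ e → if lookup x e then ℕtoℚ (h (lookup y e)) else 0ℚ)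
        ≡⟨ Σ∈-∩ (∁ z) x _ ⟩
      Σ∈ (∁ z ∩ x) (λ e → ℕtoℚ (h (lookup y e)))
        ≡⟨ Σ∈-count (∁ z ∩ x) y h ⟩
      ℕtoℚ (c₁ * h true + c₂ * h false)
        ≡⟨ cong ℕtoℚ count ⟩
      ℕtoℚ (suc (g ∸ u) * ((t C a) * R))
        ≡⟨ ℕtoℚ-* (suc (g ∸ u)) ((t C a) * R) ⟩
      ℕtoℚ (suc (g ∸ u)) ℚ.* ℕtoℚ ((t C a) * R)
        ≡⟨ cong (ℕtoℚ (suc (g ∸ u)) ℚ.*_) (kronC-entry a s y z) ⟨
      ℕtoℚ (suc (g ∸ u)) ℚ.* kronC n x a s y z ∎
      where
      open ≡-Reasoning
      ∣z∣≡ = proj₁ (Γ⁻ false (suc g) z∈)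
      ∣z∩x∣+1+g≡ = proj₂ (Γ⁻ false (suc g) z∈)
      ∣y∩x∣+u≡ = proj₂ (Γ⁻ false u y∈)
      a = m ∸ suc g
      t = inner y z
      R = outer y z C s
      h : Bool → ℕ
      h b = ((⟦ b ⟧ + t) C (m ∸ g)) * R
      c₁ = ∣ (∁ z ∩ x) ∩ y ∣
      c₂ = ∣ (∁ z ∩ x) ∩ ∁ y ∣
      ∣z∩x∣≡a : ∣ z ∩ x ∣ ≡ a
      ∣z∩x∣≡a = trans (sym (ℕP.m+n∸n≡m ∣ z ∩ x ∣ (suc g))) (cong (_∸ suc g) ∣z∩x∣+1+g≡)
      t≤a : t ≤ a
      t≤a = subst (t ≤_) ∣z∩x∣≡a (inner≤∣z∩x∣ y z)
      c₁+t≡ : c₁ + t ≡ ∣ y ∩ x ∣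
      c₁+t≡ = begin
        c₁ + t                                   ≡⟨ ℕP.+-comm c₁ t ⟩
        ∣ z ∩ (x ∩ y) ∣ + ∣ (∁ z ∩ x) ∩ y ∣
          ≡⟨ cong₂ (λ p q → ∣ p ∣ + ∣ q ∣) (∩-comm z (x ∩ y)) (trans (∩-assoc (∁ z) x y) (∩-comm (∁ z) (x ∩ y))) ⟩
        ∣ (x ∩ y) ∩ z ∣ + ∣ (x ∩ y) ∩ ∁ z ∣      ≡⟨ ∣p∩q∣+∣p∩∁q∣≡∣p∣ (x ∩ y) z ⟩
        ∣ x ∩ y ∣                                ≡⟨ cong ∣_∣ (∩-comm x y) ⟩
        ∣ y ∩ x ∣                                ∎
      c₁+t≡k+a : c₁ + t ≡ suc (g ∸ u) + a
      c₁+t≡k+a = ℕP.+-cancelʳ-≡ u _ _ (begin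
        c₁ + t + u                     ≡⟨ cong (_+ u) c₁+t≡ ⟩
        ∣ y ∩ x ∣ + u                  ≡⟨ ∣y∩x∣+u≡ ⟩
        m                              ≡⟨ ℕP.m∸n+n≡m 1+g≤m ⟨
        a + suc g                      ≡⟨ cong (λ c → a + suc c) (ℕP.m∸n+n≡m u≤g) ⟨
        a + suc (g ∸ u + u)            ≡⟨ regroup a (g ∸ u) u ⟩
        suc (g ∸ u) + a + u            ∎)
        where
        regroup : ∀ a k u → a + suc (k + u) ≡ suc k + a + u
        regroup = solve-∀
      count : c₁ * h true + c₂ * h false ≡ suc (g ∸ u) * ((t C a) * R)
      count = begin
        c₁ * ((suc t C (m ∸ g)) * R) + c₂ * ((t C (m ∸ g)) * R)   ≡⟨ cong (λ b → c₁ * ((suc t C b) * R) + c₂ * ((t C b) * R)) m∸g≡1+a ⟩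
        c₁ * ((suc t C suc a) * R) + c₂ * ((t C suc a) * R)       ≡⟨ factor c₁ c₂ (suc t C suc a) (t C suc a) R ⟩
        (c₁ * (suc t C suc a) + c₂ * (t C suc a)) * R             ≡⟨ cong (_* R) (c*[1+t]C[1+a]+d*tC[1+a]≡k*tCa {d = c₂} t≤a c₁+t≡k+a) ⟩
        (suc (g ∸ u) * (t C a)) * R                               ≡⟨ ℕP.*-assoc (suc (g ∸ u)) (t C a) R ⟩
        suc (g ∸ u) * ((t C a) * R)                               ∎
        where
        m∸g≡1+a : m ∸ g ≡ suc a
        m∸g≡1+a = ℕP.+-∸-assoc 1 1+g≤m
        factor : ∀ c d p q r → c * (p * r) + d * (q * r) ≡ (c * p + d * q) * r
        factor = solve-∀

  diagonal-E* : ∀ {u} → u ≤ m → Block (2 * u) (2 * u) (kronC n x (m ∸ u) u)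
  diagonal-E* {u} u≤m = E* (2 * u) , genE (2 * u) (2g≤2m+1 u≤m) , entries
    where
    entries : Agrees (2 * u) (2 * u) (E* (2 * u)) (kronC n x (m ∸ u) u)
    entries y z y∈ z∈ = begin
      E* (2 * u) y z
        ≡⟨ E*-entry (2 * u) y z ⟩
      boolℚ ((Γ (2 * u) y ∧ Γ (2 * u) z) ∧ (z ⊆[ 0 ] y))
        ≡⟨ cong (λ b → boolℚ (b ∧ (z ⊆[ 0 ] y))) (cong₂ _∧_ y∈ z∈) ⟩
      boolℚ (does (z ⊆? y) ∧ (∣ z ∣ ≡ᵇ ∣ y ∣))
        ≡⟨ cong (λ b → boolℚ (does (z ⊆? y) ∧ b)) (≡ᵇ-true (trans ∣z∣≡ (sym ∣y∣≡))) ⟩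
      boolℚ (does (z ⊆? y) ∧ true)
        ≡⟨ cong boolℚ (trans (∧-identityʳ _) (does-⊆?≡∣p∩q∣≡ᵇ∣p∣ z y)) ⟩
      boolℚ (∣ z ∩ y ∣ ≡ᵇ ∣ z ∣)
        ≡⟨ boolℚ≡ℕtoℚ⟦⟧ _ ⟩
      ℕtoℚ ⟦ ∣ z ∩ y ∣ ≡ᵇ ∣ z ∣ ⟧
        ≡⟨ cong₂ (λ p q → ℕtoℚ ⟦ p ≡ᵇ q ⟧) (∣z∩y∣≡inner+outer y z) (trans ∣z∣≡ (sym (ℕP.m∸n+n≡m u≤m))) ⟩
      ℕtoℚ ⟦ inner y z + outer y z ≡ᵇ (m ∸ u) + u ⟧
        ≡⟨ cong ℕtoℚ (tCa*uCb≡⟦t+u≡ᵇa+b⟧ inner≤ outer≤) ⟨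
      ℕtoℚ ((inner y z C (m ∸ u)) * (outer y z C u))
        ≡⟨ kronC-entry (m ∸ u) u y z ⟨
      kronC n x (m ∸ u) u y z ∎
      where
      open ≡-Reasoning
      ∣y∣≡ = proj₁ (Γ⁻ false u y∈)
      ∣z∣≡ = proj₁ (Γ⁻ false u z∈)
      ∣z∩x∣+u≡ = proj₂ (Γ⁻ false u z∈)
      inner≤ : inner y z ≤ m ∸ u
      inner≤ = subst (inner y z ≤_) (trans (sym (ℕP.m+n∸n≡m ∣ z ∩ x ∣ u)) (cong (_∸ u) ∣z∩x∣+u≡)) (inner≤∣z∩x∣ y z)
      outer≤ : outer y z ≤ u
      outer≤ = subst (outer y z ≤_) (∣p∩∁q∣≡ z x 0 ∣z∣≡ ∣z∩x∣+u≡) (outer≤∣z∩∁x∣ y z)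

  insertion-out-term : ∀ {i u s M} → Agrees i (suc (2 * u)) M (kronC n x (m ∸ u) s) →
    ∀ {y z e} → Γ i y ≡ true → ∣ z ∣ ≡ m → ∣ z ∩ x ∣ + u ≡ m → lookup (∁ z) e ≡ true →
    boolℚ (Γ (suc (2 * u)) (z [ e ]≔ inside)) ℚ.* M y (z [ e ]≔ inside)
    ≡ (if lookup (∁ x) e then ℕtoℚ ((inner y z C (m ∸ u)) * ((⟦ lookup y e ⟧ + outer y z) C s)) else 0ℚ)
  insertion-out-term {i} {u} {s} {M} M≈ {y} {z} {e} y∈ ∣z∣≡ ∣z∩x∣+u≡ e∈∁z =
    trans (by-x (lookup x e) refl) (cong (λ b → if b then V else 0ℚ) (sym (VecP.lookup-map e not x)))
    where
    w = z [ e ]≔ inside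
    e∉z = ∈∁⇒∉ {p = z} {e} e∈∁z
    V = ℕtoℚ ((inner y z C (m ∸ u)) * ((⟦ lookup y e ⟧ + outer y z) C s))
    by-x : ∀ b → lookup x e ≡ b → boolℚ (Γ (suc (2 * u)) w) ℚ.* M y w ≡ (if not b then V else 0ℚ)
    by-x true e∈x = trans (cong (λ b → boolℚ b ℚ.* M y w) (Γ-off true u w-off)) (ℚP.*-zeroˡ (M y w))
      where
      open ≡-Reasoning
      w-off : ∣ w ∩ x ∣ + u ≢ m
      w-off eq = ℕP.1+n≢n (begin
        suc m                            ≡⟨ cong suc ∣z∩x∣+u≡ ⟨
        suc (∣ z ∩ x ∣ + u)              ≡⟨ cong (λ b → ⟦ b ⟧ + ∣ z ∩ x ∣ + u) e∈x ⟨
        ⟦ lookup x e ⟧ + ∣ z ∩ x ∣ + u   ≡⟨ cong (_+ u) (∣p∩q∣-insert z e e∉z x) ⟨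
        ∣ w ∩ x ∣ + u                    ≡⟨ eq ⟩
        m                                ∎)
    by-x false e∉x = trans (term-on-level i (suc (2 * u)) (m ∸ u) s M y w M≈ y∈ w∈Γ)
                               (cong₂ (λ a b → ℕtoℚ ((a C (m ∸ u)) * (b C s))) inner-w outer-w)
      where
      ∣w∩x∣≡ : ∣ w ∩ x ∣ ≡ ∣ z ∩ x ∣
      ∣w∩x∣≡ = trans (∣p∩q∣-insert z e e∉z x) (cong (λ b → ⟦ b ⟧ + ∣ z ∩ x ∣) e∉x)
      w∈Γ : Γ (suc (2 * u)) w ≡ true
      w∈Γ = Γ⁺ true u (trans (∣p∣-insert z e e∉z) (cong suc ∣z∣≡)) (trans (cong (_+ u) ∣w∩x∣≡) ∣z∩x∣+u≡)
      inner-w : inner y w ≡ inner y z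
      inner-w = trans (∣p∩q∣-insert z e e∉z (x ∩ y))
                      (cong (λ b → ⟦ b ⟧ + inner y z) (trans (lookup-x∩ y e) (cong (_∧ lookup y e) e∉x)))
      outer-w : outer y w ≡ ⟦ lookup y e ⟧ + outer y z
      outer-w = trans (∣p∩q∣-insert z e e∉z (∁ x ∩ y))
                      (cong (λ b → ⟦ b ⟧ + outer y z) (trans (lookup-∁x∩ y e) (cong (λ b → not b ∧ lookup y e) e∉x)))

  diagonal-lower : ∀ {u s} → 3 * m ≤ n → ∣ x ∣ ≡ m → u ≤ m → suc s ≤ u →
    Block (2 * u) (2 * u) (kronC n x (m ∸ u) (suc s)) → Block (2 * u) (2 * u) (kronC n x (m ∸ u) s)
  diagonal-lower {u} {s} 3m≤n ∣x∣≡m u≤m 1+s≤u (M₀ , M₀∈T , M₀≈) =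
    lower (odd-from-even {2 * u} {u} {suc s} (2g≤2m+1 u≤m) 1+s≤u (M₀ , M₀∈T , M₀≈))
    where
    -- The coefficient K is independent of y and z because |∁ z ∩ ∁ x| = n - m - u on Γ_{2u};
    -- n ≥ 3m gives s + 1 ≤ n - m - u, so the truncated subtraction in K is exact.
    K = n ∸ m ∸ u ∸ suc s
    k = u ∸ suc s
    lower : Block (2 * u) (suc (2 * u)) (kronC n x (m ∸ u) (suc s)) → Block (2 * u) (2 * u) (kronC n x (m ∸ u) s)
    lower (M₁ , M₁∈T , M₁≈) =
      block-from-multiple {2 * u} {2 * u} k (kronC n x (m ∸ u) s)
        (add (mul (mul M₁∈T (genE (suc (2 * u)) (1+2g≤2m+1 u≤m))) genA) (scale (ℚ.- ℕtoℚ K) M₀∈T)) entries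
      where
      entries : Agrees (2 * u) (2 * u) (((M₁ ⊙ E* (suc (2 * u))) ⊙ A) ⊕ ((ℚ.- ℕtoℚ K) · M₀))
                       (λ y z → ℕtoℚ (suc k) ℚ.* kronC n x (m ∸ u) s y z)
      entries y z y∈ z∈ = begin
        ((M₁ ⊙ E* (suc (2 * u))) ⊙ A) y z ℚ.+ (ℚ.- ℕtoℚ K) ℚ.* M₀ y z
          ≡⟨ cong₂ (λ p q → p ℚ.+ (ℚ.- ℕtoℚ K) ℚ.* q) raised (trans (M₀≈ y z y∈ z∈) (kronC-entry (m ∸ u) (suc s) y z)) ⟩
        ℕtoℚ (K * B₁ + suc k * B₀) ℚ.+ (ℚ.- ℕtoℚ K) ℚ.* ℕtoℚ B₁
          ≡⟨ cong (ℚ._+ (ℚ.- ℕtoℚ K) ℚ.* ℕtoℚ B₁) (trans (ℕtoℚ-+ (K * B₁) _) (cong (ℚ._+ ℕtoℚ (suc k * B₀)) (ℕtoℚ-* K B₁))) ⟩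
        (ℕtoℚ K ℚ.* ℕtoℚ B₁ ℚ.+ ℕtoℚ (suc k * B₀)) ℚ.+ (ℚ.- ℕtoℚ K) ℚ.* ℕtoℚ B₁
          ≡⟨ a*b+c+[-a]*b≡c (ℕtoℚ K) (ℕtoℚ B₁) _ ⟩
        ℕtoℚ (suc k * B₀)
          ≡⟨ ℕtoℚ-* (suc k) B₀ ⟩
        ℕtoℚ (suc k) ℚ.* ℕtoℚ B₀
          ≡⟨ cong (ℕtoℚ (suc k) ℚ.*_) (kronC-entry (m ∸ u) s y z) ⟨
        ℕtoℚ (suc k) ℚ.* kronC n x (m ∸ u) s y z ∎
        where
        open ≡-Reasoning
        ∣y∣≡ = proj₁ (Γ⁻ false u y∈)
        ∣y∩x∣+u≡ = proj₂ (Γ⁻ false u y∈)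
        ∣z∣≡ = proj₁ (Γ⁻ false u z∈)
        ∣z∩x∣+u≡ = proj₂ (Γ⁻ false u z∈)
        X = inner y z C (m ∸ u)
        r = outer y z
        B₁ = X * (r C suc s)
        B₀ = X * (r C s)
        h : Bool → ℕ
        h b = X * ((⟦ b ⟧ + r) C suc s)
        S = ∁ z ∩ ∁ x
        c₁ = ∣ S ∩ y ∣
        c₂ = ∣ S ∩ ∁ y ∣
        c₁+r≡u : c₁ + r ≡ u
        c₁+r≡u = begin
          c₁ + r                                    ≡⟨ ℕP.+-comm c₁ r ⟩
          ∣ z ∩ (∁ x ∩ y) ∣ + ∣ S ∩ y ∣
            ≡⟨ cong₂ (λ p q → ∣ p ∣ + ∣ q ∣) (∩-comm z (∁ x ∩ y)) (trans (∩-assoc (∁ z) (∁ x) y) (∩-comm (∁ z) (∁ x ∩ y))) ⟩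
          ∣ (∁ x ∩ y) ∩ z ∣ + ∣ (∁ x ∩ y) ∩ ∁ z ∣   ≡⟨ ∣p∩q∣+∣p∩∁q∣≡∣p∣ (∁ x ∩ y) z ⟩
          ∣ ∁ x ∩ y ∣                               ≡⟨ cong ∣_∣ (∩-comm (∁ x) y) ⟩
          ∣ y ∩ ∁ x ∣                               ≡⟨ ∣p∩∁q∣≡ y x 0 ∣y∣≡ ∣y∩x∣+u≡ ⟩
          u                                         ∎
        ∣S∣≡ : ∣ S ∣ ≡ n ∸ m ∸ u
        ∣S∣≡ = begin
          ∣ S ∣                                     ≡⟨ ℕP.m+n∸m≡n u ∣ S ∣ ⟨
          u + ∣ S ∣ ∸ u                             ≡⟨ cong (λ c → c + ∣ S ∣ ∸ u) ∣∁z∩x∣≡u ⟨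
          ∣ ∁ z ∩ x ∣ + ∣ S ∣ ∸ u                   ≡⟨ cong (_∸ u) (∣p∩q∣+∣p∩∁q∣≡∣p∣ (∁ z) x) ⟩
          ∣ ∁ z ∣ ∸ u                               ≡⟨ cong (_∸ u) (trans (∣∁p∣≡n∸∣p∣ z) (cong (n ∸_) ∣z∣≡)) ⟩
          n ∸ m ∸ u                                 ∎
          where
          ∣∁z∩x∣≡u : ∣ ∁ z ∩ x ∣ ≡ u
          ∣∁z∩x∣≡u = trans (cong ∣_∣ (∩-comm (∁ z) x))
                           (∣p∩∁q∣≡ x z 0 ∣x∣≡m (trans (cong (λ p → ∣ p ∣ + u) (∩-comm x z)) ∣z∩x∣+u≡))
        1+s≤∣S∣ : suc s ≤ ∣ S ∣
        1+s≤∣S∣ = ℕP.≤-trans 1+s≤u (ℕP.≤-trans u≤m (subst (m ≤_) (sym ∣S∣≡) (3m≤n⇒m≤n∸m∸u 3m≤n u≤m)))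
        count : c₁ * h true + c₂ * h false ≡ K * B₁ + suc k * B₀
        count = begin
          c₁ * (X * (suc r C suc s)) + c₂ * (X * (r C suc s))   ≡⟨ factor c₁ c₂ X (suc r C suc s) (r C suc s) ⟩
          X * (c₁ * (suc r C suc s) + c₂ * (r C suc s))
            ≡⟨ cong (X *_) (c*[1+r]C[1+s]+d*rC[1+s]≡[c+d∸1+s]*rC[1+s]+[c+r∸s]*rCs c₁ c₂ r s 1+s≤c₁+c₂) ⟩
          X * ((c₁ + c₂ ∸ suc s) * (r C suc s) + (c₁ + r ∸ s) * (r C s))
            ≡⟨ cong₂ (λ p q → X * ((p ∸ suc s) * (r C suc s) + (q ∸ s) * (r C s))) c₁+c₂≡ c₁+r≡u ⟩
          X * (K * (r C suc s) + (u ∸ s) * (r C s))            ≡⟨ cong (λ p → X * (K * (r C suc s) + p * (r C s))) (ℕP.+-∸-assoc 1 1+s≤u) ⟩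
          X * (K * (r C suc s) + suc k * (r C s))              ≡⟨ distribute X K (r C suc s) (suc k) (r C s) ⟩
          K * B₁ + suc k * B₀                                  ∎
          where
          c₁+c₂≡ : c₁ + c₂ ≡ n ∸ m ∸ u
          c₁+c₂≡ = trans (∣p∩q∣+∣p∩∁q∣≡∣p∣ S y) ∣S∣≡
          1+s≤c₁+c₂ : suc s ≤ c₁ + c₂
          1+s≤c₁+c₂ = subst (suc s ≤_) (sym (∣p∩q∣+∣p∩∁q∣≡∣p∣ S y)) 1+s≤∣S∣
          factor : ∀ a b c p q → a * (c * p) + b * (c * q) ≡ c * (a * p + b * q)
          factor = solve-∀
          distribute : ∀ c a p b q → c * (a * p + b * q) ≡ a * (c * p) + b * (c * q)
          distribute = solve-∀
        raised : ((M₁ ⊙ E* (suc (2 * u))) ⊙ A) y z ≡ ℕtoℚ (K * B₁ + suc k * B₀)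
        raised = begin
          ((M₁ ⊙ E* (suc (2 * u))) ⊙ A) y z
            ≡⟨ ⊙E*⊙A-up M₁ (suc (2 * u)) y ∣z∣≡ ⟩
          Σ∈ (∁ z) (λ e → boolℚ (Γ (suc (2 * u)) (z [ e ]≔ inside)) ℚ.* M₁ y (z [ e ]≔ inside))
            ≡⟨ Σ∈-cong (∁ z) (λ e → insertion-out-term {2 * u} {u} {suc s} M₁≈ y∈ ∣z∣≡ ∣z∩x∣+u≡) ⟩
          Σ∈ (∁ z) (λ e → if lookup (∁ x) e then ℕtoℚ (h (lookup y e)) else 0ℚ)
            ≡⟨ Σ∈-∩ (∁ z) (∁ x) _ ⟩
          Σ∈ S (λ e → ℕtoℚ (h (lookup y e)))
            ≡⟨ Σ∈-count S y h ⟩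
          ℕtoℚ (c₁ * h true + c₂ * h false)
            ≡⟨ cong ℕtoℚ count ⟩
          ℕtoℚ (K * B₁ + suc k * B₀) ∎

  diagonal-block : ∀ {u s} → 3 * m ≤ n → ∣ x ∣ ≡ m → u ≤ m → s ≤ u → Block (2 * u) (2 * u) (kronC n x (m ∸ u) s)
  diagonal-block {u} {s} 3m≤n ∣x∣≡m u≤m s≤u =
    subst (λ t → Block (2 * u) (2 * u) (kronC n x (m ∸ u) t)) (ℕP.m∸[m∸n]≡n s≤u) (below (u ∸ s) (ℕP.m∸n≤m u s))
    where
    below : ∀ d → d ≤ u → Block (2 * u) (2 * u) (kronC n x (m ∸ u) (u ∸ d))
    below zero    _     = diagonal-E* u≤m
    below (suc d) 1+d≤u =
      diagonal-lower 3m≤n ∣x∣≡m u≤m (subst (_≤ u) u∸d≡ (ℕP.m∸n≤m u d))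
        (subst (λ t → Block (2 * u) (2 * u) (kronC n x (m ∸ u) t)) u∸d≡ (below d (ℕP.<⇒≤ 1+d≤u)))
      where
      u∸d≡ : u ∸ d ≡ suc (u ∸ suc d)
      u∸d≡ = ℕP.+-∸-assoc 1 1+d≤u

  even-block : ∀ {u s} g → 3 * m ≤ n → ∣ x ∣ ≡ m → s ≤ u → u ≤ g → g ≤ m →
    Block (2 * u) (2 * g) (kronC n x (m ∸ g) s)
  odd-block : ∀ {u s} g → 3 * m ≤ n → ∣ x ∣ ≡ m → s ≤ u → u ≤ g → g ≤ m →
    Block (2 * u) (suc (2 * g)) (kronC n x (m ∸ g) s)

  even-block zero    3m≤n ∣x∣≡m s≤u z≤n g≤m = diagonal-block 3m≤n ∣x∣≡m g≤m s≤u
  even-block {u} {s} (suc g) 3m≤n ∣x∣≡m s≤u u≤1+g 1+g≤m = by-cases (ℕP.m≤n⇒m<n∨m≡n u≤1+g)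
    where
    by-cases : u < suc g ⊎ u ≡ suc g → Block (2 * u) (2 * suc g) (kronC n x (m ∸ suc g) s)
    by-cases (inj₁ (s≤s u≤g)) =
      even-from-odd {u} {g} {s} (1+2g≤2m+1 g≤m) u≤g 1+g≤m (odd-block g 3m≤n ∣x∣≡m s≤u u≤g g≤m)
      where g≤m = ℕP.<⇒≤ 1+g≤m
    by-cases (inj₂ u≡1+g) = subst (λ v → Block (2 * v) (2 * suc g) (kronC n x (m ∸ suc g) s)) (sym u≡1+g)
                                  (diagonal-block 3m≤n ∣x∣≡m 1+g≤m (subst (s ≤_) u≡1+g s≤u))

  odd-block {u} {s} g 3m≤n ∣x∣≡m s≤u u≤g g≤m =
    odd-from-even {2 * u} {g} {s} (2g≤2m+1 g≤m) (ℕP.≤-trans s≤u u≤g) (even-block g 3m≤n ∣x∣≡m s≤u u≤g g≤m)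

  kron-block : ∀ {u s} b g → 3 * m ≤ n → ∣ x ∣ ≡ m → s ≤ u → u ≤ g → g ≤ m →
    Block (2 * u) (⟦ b ⟧ + 2 * g) (kronC n x (m ∸ g) s)
  kron-block true  = odd-block
  kron-block false = even-block

lemma3p2 : (n m : ℕ) → 3 * m ≤ n → (x : Subset n) → ∣ x ∣ ≡ m →
    (i j s : ℕ) → 2 * i + 2 ≤ j → j ≤ 2 * m + 1 → s ≤ suc i →
    InTblock n m x (2 * i + 2) j (kronC n x (m ∸ j / 2) s)
lemma3p2 n m 3m≤n x ∣x∣≡m i j s 2i+2≤j j≤2m+1 s≤1+i =
  subst₂ (λ r c → InTblock n m x r c (kronC n x (m ∸ j / 2) s)) (2[1+i]≡2i+2 i) (sym j≡)
    (kron-block b (j / 2) 3m≤n ∣x∣≡m s≤1+i 1+i≤j/2 j/2≤m)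
  where
  open Blocks n m x
  b = proj₁ (j≡⟦b⟧+2[j/2] j)
  j≡ = proj₂ (j≡⟦b⟧+2[j/2] j)
  2[1+i]≡2i+2 : ∀ i → 2 * suc i ≡ 2 * i + 2
  2[1+i]≡2i+2 = solve-∀
  1+i≤j/2 : suc i ≤ j / 2
  1+i≤j/2 = subst (_≤ j / 2) ([⟦b⟧+2g]/2≡g false (suc i)) (/-monoˡ-≤ 2 (subst (_≤ j) (sym (2[1+i]≡2i+2 i)) 2i+2≤j))
  j/2≤m : j / 2 ≤ m
  j/2≤m = subst (j / 2 ≤_) ([⟦b⟧+2g]/2≡g true m) (/-monoˡ-≤ 2 (subst (j ≤_) (ℕP.+-comm (2 * m) 1) j≤2m+1))
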